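{- For every $D\ge3$ there is no graph of degree $3$, diameter $D$ and cyclic defect. Furthermore, for every odd $g\ge5$ there is no graph of degree $3$, girth $g$ and cyclic excess.
   Context: For an integer $d\ge 1$ define polynomials $G_{d,m}(x)$ by $G_{d,0}(x)=1$, $G_{d,1}(x)=x+1$, and $G_{d,m+1}(x)=xG_{d,m}(x)-(d-1)G_{d,m-1}(x)$ for $m\ge1$. Let $J_n$ be the $n\times n$ all-ones matrix. For a graph on $n\ge3$ vertices, a cycle matrix is the adjacency matrix $B$ of an $n$-cycle on the same vertex set (i.e., for some ordering $v_1,\dots,v_n$ of the vertices, $B_{ij}=1$ iff $v_i,v_j$ are cyclically consecutive, and $0$ otherwise); this cycle need not consist of edges of the graph. A graph $\Gamma$ of order $n$ with adjacency matrix $A$ is a graph of degree $d$, diameter $D$ and cyclic defect if $\Gamma$ is $d$-regular with $d\ge3$, has diameter $D\ge2$, and $G_{d,D}(A)=J_n+B$ for some cycle matrix $B$. It is a graph of degree $d$, girth $g$ and cyclic excess if $\Gamma$ is $d$-regular with $d\ge3$, has odd girth $g\ge5$, and $G_{d,\lfloor g/2\rfloor}(A)=J_n-B$ for some cycle matrix $B$. -}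

module Defs where

open import Data.Bool using (Bool; true; false; if_then_else_)
open import Data.Nat using (ℕ; zero; suc; _+_; _∸_; _≤_; _<_; _%_; ⌊_/2⌋)
open import Data.Fin using (Fin; toℕ)
open import Data.Integer as ℤ using (ℤ)
open import Data.Product using (Σ; ∃; _×_; _,_)
open import Data.Sum using (_⊎_)
open import Relation.Nullary using (¬_)
open import Relation.Nullary.Decidable using (⌊_⌋)
open import Relation.Binary.PropositionalEquality using (_≡_)
open import Function.Definitions using (Injective)
import Data.Fin as F

sumFin : ∀ {A : Set} → (A → A → A) → A → ∀ n → (Fin n → A) → A
sumFin _⊕_ e zero    f = e
sumFin _⊕_ e (suc n) f = f F.zero ⊕ sumFin _⊕_ e n (λ i → f (F.suc i))

record Graph (n : ℕ) : Set where
  field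
    adj       : Fin n → Fin n → Bool
    symmetric : ∀ i j → adj i j ≡ adj j i
    loopless  : ∀ i → adj i i ≡ false
open Graph public

Mat : ℕ → Set
Mat n = Fin n → Fin n → ℤ

b2ℤ : Bool → ℤ
b2ℤ b = if b then ℤ.+ 1 else ℤ.+ 0

b2ℕ : Bool → ℕ
b2ℕ b = if b then 1 else 0

adjMat : ∀ {n} → Graph n → Mat n
adjMat Γ i j = b2ℤ (adj Γ i j)

idMat : ∀ {n} → Mat n
idMat i j = b2ℤ ⌊ i F.≟ j ⌋

onesMat : ∀ {n} → Mat n
onesMat i j = ℤ.+ 1

_+ᴹ_ : ∀ {n} → Mat n → Mat n → Mat n
(M +ᴹ N) i j = M i j ℤ.+ N i j

_-ᴹ_ : ∀ {n} → Mat n → Mat n → Mat n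
(M -ᴹ N) i j = M i j ℤ.- N i j

_·ᴹ_ : ℤ → ∀ {n} → Mat n → Mat n
(c ·ᴹ M) i j = c ℤ.* M i j

_*ᴹ_ : ∀ {n} → Mat n → Mat n → Mat n
_*ᴹ_ {n} M N i j = sumFin ℤ._+_ (ℤ.+ 0) n (λ k → M i k ℤ.* N k j)

Gpoly : ℕ → ∀ {n} → Mat n → ℕ → Mat n
Gpoly d A zero = idMat
Gpoly d A (suc zero) = A +ᴹ idMat
Gpoly d A (suc (suc m)) = (A *ᴹ Gpoly d A (suc m)) -ᴹ ((ℤ.+ (d ∸ 1)) ·ᴹ Gpoly d A m)

Regular : ∀ {n} → ℕ → Graph n → Set
Regular {n} d Γ = ∀ i → sumFin _+_ 0 n (λ j → b2ℕ (adj Γ i j)) ≡ d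

data Walk {n} (Γ : Graph n) : Fin n → Fin n → ℕ → Set where
  nil  : ∀ {i} → Walk Γ i i 0
  cons : ∀ {i j k m} → adj Γ i j ≡ true → Walk Γ j k m → Walk Γ i k (suc m)

DistLe : ∀ {n} → Graph n → Fin n → Fin n → ℕ → Set
DistLe Γ i j k = ∃ λ m → m ≤ k × Walk Γ i j m

HasDiameter : ∀ {n} → Graph n → ℕ → Set
HasDiameter Γ D = (∀ i j → DistLe Γ i j D) × (∃ λ i → ∃ λ j → ¬ DistLe Γ i j (D ∸ 1))

nextMod : ℕ → ℕ → ℕ
nextMod m p = if ⌊ suc p Data.Nat.≟ m ⌋ then 0 else suc p
  where import Data.Nat

CycConsec : ∀ {m} → Fin m → Fin m → Set
CycConsec {m} p q = (toℕ q ≡ nextMod m (toℕ p)) ⊎ (toℕ p ≡ nextMod m (toℕ q))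

HasCycleOfLength : ∀ {n} → Graph n → ℕ → Set
HasCycleOfLength {n} Γ m =
  3 ≤ m × Σ (Fin m → Fin n) λ c → Injective _≡_ _≡_ c ×
          (∀ p q → CycConsec p q → adj Γ (c p) (c q) ≡ true)

HasGirth : ∀ {n} → Graph n → ℕ → Set
HasGirth Γ g = HasCycleOfLength Γ g × (∀ m → m < g → ¬ HasCycleOfLength Γ m)

-- M = J + ε B for some cycle matrix B (ordering v of the vertices);
-- entry (v p, v q) of B is 1 iff p, q cyclically consecutive.
-- Since v is injective on Fin n, it is a bijection, so this covers every entry.
cycleBool : ∀ {n} → Fin n → Fin n → Bool
cycleBool {n} p q =
  ⌊ toℕ q Data.Nat.≟ nextMod n (toℕ p) ⌋ Data.Bool.∨ ⌊ toℕ p Data.Nat.≟ nextMod n (toℕ q) ⌋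
  where import Data.Nat; import Data.Bool

IsJPlusCycle : ∀ {n} → Mat n → Set
IsJPlusCycle {n} M = Σ (Fin n → Fin n) λ v → Injective _≡_ _≡_ v ×
  (∀ p q → M (v p) (v q) ≡ ℤ.+ 1 ℤ.+ b2ℤ (cycleBool p q))

IsJMinusCycle : ∀ {n} → Mat n → Set
IsJMinusCycle {n} M = Σ (Fin n → Fin n) λ v → Injective _≡_ _≡_ v ×
  (∀ p q → M (v p) (v q) ≡ ℤ.+ 1 ℤ.- b2ℤ (cycleBool p q))

CyclicDefect : ∀ {n} → ℕ → ℕ → Graph n → Set
CyclicDefect {n} d D Γ =
  3 ≤ n × Regular d Γ × 3 ≤ d × HasDiameter Γ D × 2 ≤ D ×
  IsJPlusCycle (Gpoly d (adjMat Γ) D)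

CyclicExcess : ∀ {n} → ℕ → ℕ → Graph n → Set
CyclicExcess {n} d g Γ =
  3 ≤ n × Regular d Γ × 3 ≤ d × HasGirth Γ g × g % 2 ≡ 1 × 5 ≤ g ×
  IsJMinusCycle (Gpoly d (adjMat Γ) ⌊ g /2⌋)

-- Write the equation as G(A) = J + sB with s = 1 (defect) or s = −1 (excess), and relabel the
-- vertices along the cycle so that B is the adjacency matrix of the standard n-cycle. Since G(A)
-- and J commute with A, so does B. Applying G(A) to the all-ones vector gives G(3) = n + 2s, and
-- G(3) ≡ 2 (mod 4) forces 4 ∣ n. The alternating vector σ then spans the (−2)-eigenspace of B, so
-- it is an eigenvector of A; its eigenvalue μ is a sum of three signs, hence odd with |μ| ≤ 3, and
-- G(μ) = −2s. Congruences for G rule out s = 1 and force μ = −1 when s = −1. In that case A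
-- preserves the kernel of B, spanned by U = cos(πp/2) and W = sin(πp/2), and acts on it by an
-- integer matrix that is the identity mod 2. From G(A)U = 0 a computation mod 4 shows that
-- AU = aU with a odd and |a| ≤ 3, so G(a) = 0, which the congruences for G exclude again.

module Submission where

open import Defs
open import Data.Nat using (ℕ; _≤_; _%_)
open import Data.Product using (_×_)
open import Relation.Nullary using (¬_)
open import Relation.Binary.PropositionalEquality using (_≡_)

import Data.Fin.Permutation as Perm
import Data.Fin.Properties as FinP
import Data.Integer.Properties as ℤP
import Data.Nat.Divisibility as ℕ∣
import Data.Nat.Properties as ℕP
open import Algebra.Properties.AbelianGroup ℤP.+-0-abelianGroup using (∙-cancelˡ; inverseˡ-unique; x≈z//y)
open import Algebra.Properties.Semiring.Sum ℤP.+-*-semiring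
  using (sum; sum-syntax; sum-cong-≗; sum-remove; sum-permute; sum-replicate-zero;
         ∑-comm; ∑-distrib-+; *-distribˡ-sum; *-distribʳ-sum)
open import Data.Bool using (Bool; true; false; _∨_; T)
open import Data.Empty using (⊥; ⊥-elim)
open import Data.Fin as Fin using (Fin; toℕ)
open import Data.Fin.Patterns using (0F; 1F)
open import Data.Integer as ℤ using (ℤ; +_; _+_; _*_; _-_; -_)
open import Data.Integer.Divisibility.Signed
  using (_∣_; _∣?_; divides; ∣m∣n⇒∣m+n; ∣m∣n⇒∣m-n; ∣n⇒∣m*n; ∣m⇒∣-m; ∣⇒∣ᵤ)
open import Data.Integer.Tactic.RingSolver using (solve-∀)
open import Data.Nat as ℕ using (zero; suc; _∸_; _<_; z≤n; s≤s)
open import Data.Nat.Tactic.RingSolver using () renaming (solve-∀ to ℕ-solve-∀)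
open import Data.Product using (∃; _,_; proj₁; proj₂; uncurry)
open import Data.Sum using (inj₂)
open import Data.Unit using (tt)
open import Data.Vec.Functional using (Vector; removeAt)
open import Function using (_∘_; mk⇔)
open import Function.Bundles using (_⇔_)
open import Function.Definitions using (Injective)
open import Relation.Binary.PropositionalEquality
open import Relation.Nullary using (Dec; yes; no; contradiction)
open import Relation.Nullary.Decidable using (⌊_⌋; isYes≗does; does-⇔; toWitness; False; toWitnessFalse)

sumFin≡sum : ∀ {n} (f : Vector ℤ n) → sumFin _+_ (+ 0) n f ≡ sum f
sumFin≡sum {zero}  f = refl
sumFin≡sum {suc n} f = cong (_+_ (f Fin.zero)) (sumFin≡sum (f ∘ Fin.suc))

∑-distrib-* : ∀ {n} c (f : Vector ℤ n) → ∑[ i < n ] (c * f i) ≡ c * sum f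
∑-distrib-* c f = sym (*-distribˡ-sum c f)

∑-distrib-- : ∀ {n} (f g : Vector ℤ n) → ∑[ i < n ] (f i - g i) ≡ sum f - sum g
∑-distrib-- {n} f g = begin
  ∑[ i < n ] (f i - g i)          ≡⟨ ∑-distrib-+ f (λ i → - g i) ⟩
  sum f + ∑[ i < n ] (- g i)      ≡⟨ cong (_+_ (sum f)) (sum-cong-≗ (λ i → sym (ℤP.-1*i≡-i (g i)))) ⟩
  sum f + ∑[ i < n ] (- + 1 * g i) ≡⟨ cong (_+_ (sum f)) (∑-distrib-* (- + 1) g) ⟩
  sum f + - + 1 * sum g           ≡⟨ cong (_+_ (sum f)) (ℤP.-1*i≡-i (sum g)) ⟩
  sum f - sum g                   ∎
  where open ≡-Reasoning

∑-const-1 : ∀ n → ∑[ i < n ] (+ 1) ≡ + n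
∑-const-1 zero    = refl
∑-const-1 (suc n) = cong (_+_ (+ 1)) (∑-const-1 n)

∑-single : ∀ {n} (f : Vector ℤ n) i → (∀ j → j ≢ i → f j ≡ + 0) → sum f ≡ f i
∑-single {suc n} f i vanishes = begin
  sum f                    ≡⟨ sum-remove {i = i} f ⟩
  f i + sum (removeAt f i) ≡⟨ cong (_+_ (f i)) (sum-cong-≗ (λ j → vanishes _ (FinP.punchInᵢ≢i i j))) ⟩
  f i + ∑[ j < n ] (+ 0)  ≡⟨ cong (_+_ (f i)) (sum-replicate-zero n) ⟩
  f i + + 0                ≡⟨ ℤP.+-identityʳ (f i) ⟩
  f i                      ∎
  where open ≡-Reasoning

injective⇒surjective : ∀ {n} (v : Fin n → Fin n) → Injective _≡_ _≡_ v → ∀ j → ∃ λ i → v i ≡ j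
injective⇒surjective {zero}  v inj ()
injective⇒surjective {suc m} v inj j with FinP.any? (λ i → v i Fin.≟ j)
... | yes hit = hit
... | no miss = contradiction (FinP.injective⇒≤ squeezed-injective) ℕP.1+n≰n
  where
  avoids : ∀ i → j ≢ v i
  avoids i eq = miss (i , sym eq)
  squeezed : Fin (suc m) → Fin m
  squeezed i = Fin.punchOut (avoids i)
  squeezed-injective : Injective _≡_ _≡_ squeezed
  squeezed-injective eq = inj (FinP.punchOut-injective (avoids _) (avoids _) eq)

∑-injective-reindex : ∀ {n} (v : Fin n → Fin n) → Injective _≡_ _≡_ v →
                      (f : Vector ℤ n) → sum f ≡ sum (f ∘ v)
∑-injective-reindex {n} v inj f = sum-permute f (Perm.permutation v v⁻¹ inverseʳ inverseˡ)
  where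
  v⁻¹ : Fin n → Fin n
  v⁻¹ j = proj₁ (injective⇒surjective v inj j)
  inverseʳ : ∀ j → v (v⁻¹ j) ≡ j
  inverseʳ j = proj₂ (injective⇒surjective v inj j)
  inverseˡ : ∀ i → v⁻¹ (v i) ≡ i
  inverseˡ i = inj (proj₂ (injective⇒surjective v inj (v i)))

infixr 8 _*ᵥ_

_*ᵥ_ : ∀ {n} → Mat n → Vector ℤ n → Vector ℤ n
_*ᵥ_ {n} M y i = ∑[ k < n ] (M i k * y k)

module _ {n : ℕ} where

  *ᵥ-congʳ : ∀ (M : Mat n) {y z : Vector ℤ n} → y ≗ z → M *ᵥ y ≗ M *ᵥ z
  *ᵥ-congʳ M y≗z i = sum-cong-≗ (λ k → cong (M i k *_) (y≗z k))

  *ᴹ-*ᵥ : ∀ (M N : Mat n) y → (M *ᴹ N) *ᵥ y ≗ M *ᵥ (N *ᵥ y)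
  *ᴹ-*ᵥ M N y i = begin
    ∑[ k < n ] (sumFin _+_ (+ 0) n (λ j → M i j * N j k) * y k)
      ≡⟨ sum-cong-≗ (λ k → cong (_* y k) (sumFin≡sum (λ j → M i j * N j k))) ⟩
    ∑[ k < n ] (∑[ j < n ] (M i j * N j k) * y k)
      ≡⟨ sum-cong-≗ (λ k → *-distribʳ-sum (y k) (λ j → M i j * N j k)) ⟩
    ∑[ k < n ] ∑[ j < n ] (M i j * N j k * y k)
      ≡⟨ ∑-comm (λ k j → M i j * N j k * y k) ⟩
    ∑[ j < n ] ∑[ k < n ] (M i j * N j k * y k)
      ≡⟨ sum-cong-≗ (λ j → sum-cong-≗ (λ k → ℤP.*-assoc (M i j) (N j k) (y k))) ⟩
    ∑[ j < n ] ∑[ k < n ] (M i j * (N j k * y k))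
      ≡⟨ sum-cong-≗ (λ j → ∑-distrib-* (M i j) (λ k → N j k * y k)) ⟩
    ∑[ j < n ] (M i j * (N *ᵥ y) j) ∎
    where open ≡-Reasoning

  +ᴹ-*ᵥ : ∀ (M N : Mat n) y i → ((M +ᴹ N) *ᵥ y) i ≡ (M *ᵥ y) i + (N *ᵥ y) i
  +ᴹ-*ᵥ M N y i = trans (sum-cong-≗ (λ k → ℤP.*-distribʳ-+ (y k) (M i k) (N i k)))
                        (∑-distrib-+ (λ k → M i k * y k) (λ k → N i k * y k))

  -ᴹ-*ᵥ : ∀ (M N : Mat n) y i → ((M -ᴹ N) *ᵥ y) i ≡ (M *ᵥ y) i - (N *ᵥ y) i
  -ᴹ-*ᵥ M N y i = trans (sum-cong-≗ (λ k → distrib (M i k) (N i k) (y k)))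
                        (∑-distrib-- (λ k → M i k * y k) (λ k → N i k * y k))
    where
    distrib : ∀ a b c → (a - b) * c ≡ a * c - b * c
    distrib = solve-∀

  ·ᴹ-*ᵥ : ∀ c (M : Mat n) y i → ((c ·ᴹ M) *ᵥ y) i ≡ c * (M *ᵥ y) i
  ·ᴹ-*ᵥ c M y i = trans (sum-cong-≗ (λ k → ℤP.*-assoc c (M i k) (y k)))
                        (∑-distrib-* c (λ k → M i k * y k))

  idMat-*ᵥ : ∀ (y : Vector ℤ n) → idMat *ᵥ y ≗ y
  idMat-*ᵥ y i = trans (∑-single (λ j → b2ℤ ⌊ i Fin.≟ j ⌋ * y j) i off-diagonal) diagonal
    where
    off-diagonal : ∀ j → j ≢ i → b2ℤ ⌊ i Fin.≟ j ⌋ * y j ≡ + 0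
    off-diagonal j j≢i with i Fin.≟ j
    ... | yes i≡j = contradiction (sym i≡j) j≢i
    ... | no _    = ℤP.*-zeroˡ (y j)
    diagonal : b2ℤ ⌊ i Fin.≟ i ⌋ * y i ≡ y i
    diagonal with i Fin.≟ i
    ... | yes _  = ℤP.*-identityˡ (y i)
    ... | no i≢i = contradiction refl i≢i

  *ᵥ-+ : ∀ (M : Mat n) y z i → (M *ᵥ (λ k → y k + z k)) i ≡ (M *ᵥ y) i + (M *ᵥ z) i
  *ᵥ-+ M y z i = trans (sum-cong-≗ (λ k → ℤP.*-distribˡ-+ (M i k) (y k) (z k)))
                       (∑-distrib-+ (λ k → M i k * y k) (λ k → M i k * z k))

  *ᵥ-- : ∀ (M : Mat n) y z i → (M *ᵥ (λ k → y k - z k)) i ≡ (M *ᵥ y) i - (M *ᵥ z) i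
  *ᵥ-- M y z i = trans (sum-cong-≗ (λ k → distrib (M i k) (y k) (z k)))
                       (∑-distrib-- (λ k → M i k * y k) (λ k → M i k * z k))
    where
    distrib : ∀ a b c → a * (b - c) ≡ a * b - a * c
    distrib = solve-∀

  *ᵥ-* : ∀ (M : Mat n) c y i → (M *ᵥ (λ k → c * y k)) i ≡ c * (M *ᵥ y) i
  *ᵥ-* M c y i = trans (sum-cong-≗ (λ k → swap (M i k) c (y k)))
                       (∑-distrib-* c (λ k → M i k * y k))
    where
    swap : ∀ a b c → a * (b * c) ≡ b * (a * c)
    swap = solve-∀

⌊⌋-⇔ : ∀ {A B : Set} → A ⇔ B → (a? : Dec A) (b? : Dec B) → ⌊ a? ⌋ ≡ ⌊ b? ⌋
⌊⌋-⇔ A⇔B a? b? = trans (isYes≗does a?) (trans (does-⇔ A⇔B a? b?) (sym (isYes≗does b?)))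

G : ℕ → ℕ → ℤ → ℤ
G d zero          x = + 1
G d (suc zero)    x = x + + 1
G d (suc (suc m)) x = x * G d (suc m) x - + (d ∸ 1) * G d m x

relabelᴹ : ∀ {n} → (Fin n → Fin n) → Mat n → Mat n
relabelᴹ v A i j = A (v i) (v j)

module _ {n} (d : ℕ) (A : Mat n) {v : Fin n → Fin n} (v-injective : Injective _≡_ _≡_ v) where

  *ᴹ-relabel : ∀ (N N′ : Mat n) → (∀ i j → N′ i j ≡ N (v i) (v j)) →
               ∀ p q → (relabelᴹ v A *ᴹ N′) p q ≡ (A *ᴹ N) (v p) (v q)
  *ᴹ-relabel N N′ N′≡N p q = begin
    sumFin _+_ (+ 0) n (λ k → A (v p) (v k) * N′ k q)
      ≡⟨ sumFin≡sum (λ k → A (v p) (v k) * N′ k q) ⟩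
    ∑[ k < n ] (A (v p) (v k) * N′ k q)
      ≡⟨ sum-cong-≗ (λ k → cong (A (v p) (v k) *_) (N′≡N k q)) ⟩
    ∑[ k < n ] (A (v p) (v k) * N (v k) (v q))
      ≡⟨ ∑-injective-reindex v v-injective (λ k → A (v p) k * N k (v q)) ⟨
    ∑[ k < n ] (A (v p) k * N k (v q))
      ≡⟨ sumFin≡sum (λ k → A (v p) k * N k (v q)) ⟨
    sumFin _+_ (+ 0) n (λ k → A (v p) k * N k (v q)) ∎
    where open ≡-Reasoning

  Gpoly-relabel : ∀ m p q → Gpoly d (relabelᴹ v A) m p q ≡ Gpoly d A m (v p) (v q)
  Gpoly-relabel zero p q = cong b2ℤ (⌊⌋-⇔ (mk⇔ (cong v) v-injective) (p Fin.≟ q) (v p Fin.≟ v q))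
  Gpoly-relabel (suc zero) p q = cong (_+_ (A (v p) (v q))) (Gpoly-relabel zero p q)
  Gpoly-relabel (suc (suc m)) p q =
    cong₂ _-_ (*ᴹ-relabel (Gpoly d A (suc m)) (Gpoly d (relabelᴹ v A) (suc m)) (Gpoly-relabel (suc m)) p q)
              (cong (+ (d ∸ 1) *_) (Gpoly-relabel m p q))

module _ {n : ℕ} (d : ℕ) (A : Mat n) where

  private
    c : ℤ
    c = + (d ∸ 1)

  Gpoly-*ᵥ-one : ∀ y i → (Gpoly d A 1 *ᵥ y) i ≡ (A *ᵥ y) i + y i
  Gpoly-*ᵥ-one y i = trans (+ᴹ-*ᵥ A idMat y i) (cong (_+_ ((A *ᵥ y) i)) (idMat-*ᵥ y i))

  Gpoly-*ᵥ-step : ∀ m y i → (Gpoly d A (suc (suc m)) *ᵥ y) i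
                          ≡ (A *ᵥ (Gpoly d A (suc m) *ᵥ y)) i - c * (Gpoly d A m *ᵥ y) i
  Gpoly-*ᵥ-step m y i = trans (-ᴹ-*ᵥ (A *ᴹ Gpoly d A (suc m)) (c ·ᴹ Gpoly d A m) y i)
                              (cong₂ _-_ (*ᴹ-*ᵥ A (Gpoly d A (suc m)) y i) (·ᴹ-*ᵥ c (Gpoly d A m) y i))

  Gpoly-*ᵥ-comm : ∀ m y → Gpoly d A m *ᵥ (A *ᵥ y) ≗ A *ᵥ (Gpoly d A m *ᵥ y)
  Gpoly-*ᵥ-comm zero y i = trans (idMat-*ᵥ (A *ᵥ y) i) (sym (*ᵥ-congʳ A (idMat-*ᵥ y) i))
  Gpoly-*ᵥ-comm (suc zero) y i = begin
    (Gpoly d A 1 *ᵥ (A *ᵥ y)) i             ≡⟨ Gpoly-*ᵥ-one (A *ᵥ y) i ⟩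
    (A *ᵥ (A *ᵥ y)) i + (A *ᵥ y) i         ≡⟨ *ᵥ-+ A (A *ᵥ y) y i ⟨
    (A *ᵥ (λ k → (A *ᵥ y) k + y k)) i      ≡⟨ *ᵥ-congʳ A (Gpoly-*ᵥ-one y) i ⟨
    (A *ᵥ (Gpoly d A 1 *ᵥ y)) i             ∎
    where open ≡-Reasoning
  Gpoly-*ᵥ-comm (suc (suc m)) y i = begin
    (Gpoly d A (suc (suc m)) *ᵥ (A *ᵥ y)) i
      ≡⟨ Gpoly-*ᵥ-step m (A *ᵥ y) i ⟩
    (A *ᵥ (Gpoly d A (suc m) *ᵥ (A *ᵥ y))) i - c * (Gpoly d A m *ᵥ (A *ᵥ y)) i
      ≡⟨ cong₂ (λ a b → a - c * b) (*ᵥ-congʳ A (Gpoly-*ᵥ-comm (suc m) y) i) (Gpoly-*ᵥ-comm m y i) ⟩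
    (A *ᵥ (A *ᵥ (Gpoly d A (suc m) *ᵥ y))) i - c * (A *ᵥ (Gpoly d A m *ᵥ y)) i
      ≡⟨ cong (_-_ ((A *ᵥ (A *ᵥ (Gpoly d A (suc m) *ᵥ y))) i)) (*ᵥ-* A c (Gpoly d A m *ᵥ y) i) ⟨
    (A *ᵥ (A *ᵥ (Gpoly d A (suc m) *ᵥ y))) i - (A *ᵥ (λ k → c * (Gpoly d A m *ᵥ y) k)) i
      ≡⟨ *ᵥ-- A (A *ᵥ (Gpoly d A (suc m) *ᵥ y)) (λ k → c * (Gpoly d A m *ᵥ y) k) i ⟨
    (A *ᵥ (λ k → (A *ᵥ (Gpoly d A (suc m) *ᵥ y)) k - c * (Gpoly d A m *ᵥ y) k)) i
      ≡⟨ *ᵥ-congʳ A (Gpoly-*ᵥ-step m y) i ⟨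
    (A *ᵥ (Gpoly d A (suc (suc m)) *ᵥ y)) i ∎
    where open ≡-Reasoning

  Gpoly-*ᵥ-eigen : ∀ μ y → A *ᵥ y ≗ (λ k → μ * y k) → ∀ m → Gpoly d A m *ᵥ y ≗ (λ k → G d m μ * y k)
  Gpoly-*ᵥ-eigen μ y eigen zero i = trans (idMat-*ᵥ y i) (sym (ℤP.*-identityˡ (y i)))
  Gpoly-*ᵥ-eigen μ y eigen (suc zero) i =
    trans (Gpoly-*ᵥ-one y i) (trans (cong (_+ y i) (eigen i)) (collect μ (y i)))
    where
    collect : ∀ μ a → μ * a + a ≡ (μ + + 1) * a
    collect = solve-∀
  Gpoly-*ᵥ-eigen μ y eigen (suc (suc m)) i = begin
    (Gpoly d A (suc (suc m)) *ᵥ y) i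
      ≡⟨ Gpoly-*ᵥ-step m y i ⟩
    (A *ᵥ (Gpoly d A (suc m) *ᵥ y)) i - c * (Gpoly d A m *ᵥ y) i
      ≡⟨ cong₂ (λ a b → a - c * b) (*ᵥ-congʳ A (Gpoly-*ᵥ-eigen μ y eigen (suc m)) i)
                                   (Gpoly-*ᵥ-eigen μ y eigen m i) ⟩
    (A *ᵥ (λ k → G d (suc m) μ * y k)) i - c * (G d m μ * y i)
      ≡⟨ cong (λ a → a - c * (G d m μ * y i))
              (trans (*ᵥ-* A (G d (suc m) μ) y i) (cong (G d (suc m) μ *_) (eigen i))) ⟩
    G d (suc m) μ * (μ * y i) - c * (G d m μ * y i)
      ≡⟨ collect (G d (suc m) μ) (G d m μ) μ c (y i) ⟩
    G d (suc (suc m)) μ * y i ∎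
    where
    open ≡-Reasoning
    collect : ∀ g₁ g₀ μ c a → g₁ * (μ * a) - c * (g₀ * a) ≡ (μ * g₁ - c * g₀) * a
    collect = solve-∀

  Gpoly-*ᵥ-plane : ∀ (N : Mat 2) (u : Fin 2 → Vector ℤ n) →
                   (∀ j → A *ᵥ u j ≗ λ k → N 0F j * u 0F k + N 1F j * u 1F k) →
                   ∀ m j → Gpoly d A m *ᵥ u j ≗ λ k → Gpoly d N m 0F j * u 0F k + Gpoly d N m 1F j * u 1F k
  Gpoly-*ᵥ-plane N u invariant zero 0F k = trans (idMat-*ᵥ (u 0F) k) (pick (u 0F k) (u 1F k))
    where
    pick : ∀ a b → a ≡ + 1 * a + + 0 * b
    pick = solve-∀
  Gpoly-*ᵥ-plane N u invariant zero 1F k = trans (idMat-*ᵥ (u 1F) k) (pick (u 0F k) (u 1F k))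
    where
    pick : ∀ a b → b ≡ + 0 * a + + 1 * b
    pick = solve-∀
  Gpoly-*ᵥ-plane N u invariant (suc zero) 0F k =
    trans (Gpoly-*ᵥ-one (u 0F) k)
          (trans (cong (_+ u 0F k) (invariant 0F k)) (collect (N 0F 0F) (N 1F 0F) (u 0F k) (u 1F k)))
    where
    collect : ∀ a b u w → a * u + b * w + u ≡ (a + + 1) * u + (b + + 0) * w
    collect = solve-∀
  Gpoly-*ᵥ-plane N u invariant (suc zero) 1F k =
    trans (Gpoly-*ᵥ-one (u 1F) k)
          (trans (cong (_+ u 1F k) (invariant 1F k)) (collect (N 0F 1F) (N 1F 1F) (u 0F k) (u 1F k)))
    where
    collect : ∀ b′ e u w → b′ * u + e * w + w ≡ (b′ + + 0) * u + (e + + 1) * w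
    collect = solve-∀
  Gpoly-*ᵥ-plane N u invariant (suc (suc m)) j k = begin
    (Gpoly d A (suc (suc m)) *ᵥ u j) k
      ≡⟨ Gpoly-*ᵥ-step m (u j) k ⟩
    (A *ᵥ (Gpoly d A (suc m) *ᵥ u j)) k - c * (Gpoly d A m *ᵥ u j) k
      ≡⟨ cong₂ (λ a b → a - c * b) (*ᵥ-congʳ A (Gpoly-*ᵥ-plane N u invariant (suc m) j) k)
                                   (Gpoly-*ᵥ-plane N u invariant m j k) ⟩
    (A *ᵥ (λ l → g₀ * u 0F l + g₁ * u 1F l)) k - c * (h₀ * u 0F k + h₁ * u 1F k)
      ≡⟨ cong (λ a → a - c * (h₀ * u 0F k + h₁ * u 1F k)) (trans (*ᵥ-+ A _ _ k)
            (cong₂ _+_ (trans (*ᵥ-* A g₀ (u 0F) k) (cong (g₀ *_) (invariant 0F k)))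
                       (trans (*ᵥ-* A g₁ (u 1F) k) (cong (g₁ *_) (invariant 1F k))))) ⟩
    g₀ * (N 0F 0F * u 0F k + N 1F 0F * u 1F k) + g₁ * (N 0F 1F * u 0F k + N 1F 1F * u 1F k)
      - c * (h₀ * u 0F k + h₁ * u 1F k)
      ≡⟨ collect (N 0F 0F) (N 1F 0F) (N 0F 1F) (N 1F 1F) g₀ g₁ h₀ h₁ c (u 0F k) (u 1F k) ⟩
    Gpoly d N (suc (suc m)) 0F j * u 0F k + Gpoly d N (suc (suc m)) 1F j * u 1F k ∎
    where
    open ≡-Reasoning
    g₀ g₁ h₀ h₁ : ℤ
    g₀ = Gpoly d N (suc m) 0F j
    g₁ = Gpoly d N (suc m) 1F j
    h₀ = Gpoly d N m 0F j
    h₁ = Gpoly d N m 1F j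
    collect : ∀ a b b′ e g₀ g₁ h₀ h₁ c u w →
      g₀ * (a * u + b * w) + g₁ * (b′ * u + e * w) - c * (h₀ * u + h₁ * w)
      ≡ (a * g₀ + (b′ * g₁ + + 0) - c * h₀) * u + (b * g₀ + (e * g₁ + + 0) - c * h₁) * w
    collect = solve-∀

prevMod : ℕ → ℕ → ℕ
prevMod n zero    = n ∸ 1
prevMod n (suc p) = p

nextMod< : ∀ {n p} → p < n → nextMod n p < n
nextMod< {n} {p} p<n with suc p ℕ.≟ n
... | yes _        = ℕP.≤-<-trans z≤n p<n
... | no 1+p≢n     = ℕP.≤∧≢⇒< p<n 1+p≢n

prevMod< : ∀ {n p} → p < n → prevMod n p < n
prevMod< {suc n} {zero}  _   = ℕP.n<1+n n
prevMod< {n}     {suc p} p<n = ℕP.<-trans (ℕP.n<1+n p) p<n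

nextMod⇒prevMod : ∀ {n p q} → p < n → p ≡ nextMod n q → q ≡ prevMod n p
nextMod⇒prevMod {n} {p} {q} p<n eq with suc q ℕ.≟ n
nextMod⇒prevMod {p = zero}  _ _  | yes 1+q≡n = cong (_∸ 1) 1+q≡n
nextMod⇒prevMod {p = suc p} _ () | yes _
nextMod⇒prevMod {p = zero}  _ () | no _
nextMod⇒prevMod {p = suc p} _ eq | no _      = sym (ℕP.suc-injective eq)

prevMod⇒nextMod : ∀ {n p q} → p < n → q ≡ prevMod n p → p ≡ nextMod n q
prevMod⇒nextMod {n} {p} {q} p<n eq with suc q ℕ.≟ n
prevMod⇒nextMod {p = zero}             _   _    | yes _     = refl
prevMod⇒nextMod {p = suc p}            p<n refl | yes 1+p≡n = contradiction 1+p≡n (ℕP.<⇒≢ p<n)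
prevMod⇒nextMod {n = suc n} {p = zero} _   refl | no 1+q≢n  = contradiction refl 1+q≢n
prevMod⇒nextMod {p = suc p}            _   refl | no _      = refl

nextMod≢prevMod : ∀ {n p} → 3 ≤ n → p < n → nextMod n p ≢ prevMod n p
nextMod≢prevMod {n} {zero} 3≤n _ eq with 1 ℕ.≟ n
... | yes refl = contradiction 3≤n λ { (s≤s ()) }
nextMod≢prevMod {suc (suc (suc n))} {zero} _ _ () | no _
nextMod≢prevMod {suc (suc zero)}   {zero} (s≤s (s≤s ())) _ _ | no _
nextMod≢prevMod {n} {suc p} 3≤n p<n eq with suc (suc p) ℕ.≟ n
nextMod≢prevMod {n} {suc zero}    3≤n _ _  | yes 2≡n =
  contradiction 3≤n (subst (λ k → ¬ 3 ≤ k) 2≡n λ { (s≤s (s≤s ())) })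
nextMod≢prevMod {n} {suc (suc p)} _   _ () | yes _
nextMod≢prevMod {n} {suc p}       _   _ eq | no _    =
  ℕP.<⇒≢ (ℕP.<-trans (ℕP.n<1+n p) (ℕP.n<1+n (suc p))) (sym eq)

cycleMat : ∀ {n} → Mat n
cycleMat p q = b2ℤ (cycleBool p q)

∑-indicator : ∀ {n} (f : ℕ → ℤ) {c} → c < n → ∑[ q < n ] (b2ℤ ⌊ toℕ q ℕ.≟ c ⌋ * f (toℕ q)) ≡ f c
∑-indicator f {c} c<n =
  trans (∑-single (λ q → b2ℤ ⌊ toℕ q ℕ.≟ c ⌋ * f (toℕ q)) (Fin.fromℕ< c<n) elsewhere) here
  where
  elsewhere : ∀ q → q ≢ Fin.fromℕ< c<n → b2ℤ ⌊ toℕ q ℕ.≟ c ⌋ * f (toℕ q) ≡ + 0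
  elsewhere q q≢c with toℕ q ℕ.≟ c
  ... | yes q≡c = contradiction (FinP.toℕ-injective (trans q≡c (sym (FinP.toℕ-fromℕ< c<n)))) q≢c
  ... | no _    = ℤP.*-zeroˡ (f (toℕ q))
  here : b2ℤ ⌊ toℕ (Fin.fromℕ< c<n) ℕ.≟ c ⌋ * f (toℕ (Fin.fromℕ< c<n)) ≡ f c
  here rewrite FinP.toℕ-fromℕ< c<n | ℕP.≟-diag {c} refl = ℤP.*-identityˡ (f c)

b2ℤ-∨ : ∀ b c → ¬ (T b × T c) → b2ℤ (b ∨ c) ≡ b2ℤ b + b2ℤ c
b2ℤ-∨ true  true  both = contradiction (tt , tt) both
b2ℤ-∨ true  false _    = refl
b2ℤ-∨ false true  _    = refl
b2ℤ-∨ false false _    = refl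

cycleMat-split : ∀ {n} → 3 ≤ n → ∀ (p q : Fin n) →
  cycleMat p q ≡ b2ℤ ⌊ toℕ q ℕ.≟ nextMod n (toℕ p) ⌋ + b2ℤ ⌊ toℕ q ℕ.≟ prevMod n (toℕ p) ⌋
cycleMat-split {n} 3≤n p q = trans (b2ℤ-∨ _ _ not-both)
  (cong (_+_ (b2ℤ ⌊ toℕ q ℕ.≟ nextMod n (toℕ p) ⌋))
        (cong b2ℤ (⌊⌋-⇔ (mk⇔ (nextMod⇒prevMod p<n) (prevMod⇒nextMod p<n))
                        (toℕ p ℕ.≟ nextMod n (toℕ q)) (toℕ q ℕ.≟ prevMod n (toℕ p)))))
  where
  p<n : toℕ p < n
  p<n = FinP.toℕ<n p
  not-both : ¬ (T ⌊ toℕ q ℕ.≟ nextMod n (toℕ p) ⌋ × T ⌊ toℕ p ℕ.≟ nextMod n (toℕ q) ⌋)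
  not-both (q-next , p-next) =
    nextMod≢prevMod 3≤n p<n (trans (sym (toWitness q-next)) (nextMod⇒prevMod p<n (toWitness p-next)))

cycleMat-*ᵥ : ∀ {n} → 3 ≤ n → (f : ℕ → ℤ) → ∀ p →
              (cycleMat *ᵥ (f ∘ toℕ)) p ≡ f (nextMod n (toℕ p)) + f (prevMod n (toℕ p))
cycleMat-*ᵥ {n} 3≤n f p = begin
  ∑[ q < n ] (cycleMat p q * f (toℕ q))
    ≡⟨ sum-cong-≗ (λ q → trans (cong (_* f (toℕ q)) (cycleMat-split 3≤n p q))
                              (ℤP.*-distribʳ-+ (f (toℕ q)) (next q) (prev q))) ⟩
  ∑[ q < n ] (next q * f (toℕ q) + prev q * f (toℕ q))
    ≡⟨ ∑-distrib-+ (λ q → next q * f (toℕ q)) (λ q → prev q * f (toℕ q)) ⟩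
  ∑[ q < n ] (next q * f (toℕ q)) + ∑[ q < n ] (prev q * f (toℕ q))
    ≡⟨ cong₂ _+_ (∑-indicator f (nextMod< p<n)) (∑-indicator f (prevMod< p<n)) ⟩
  f (nextMod n (toℕ p)) + f (prevMod n (toℕ p)) ∎
  where
  open ≡-Reasoning
  p<n : toℕ p < n
  p<n = FinP.toℕ<n p
  next prev : Fin n → ℤ
  next q = b2ℤ ⌊ toℕ q ℕ.≟ nextMod n (toℕ p) ⌋
  prev q = b2ℤ ⌊ toℕ q ℕ.≟ prevMod n (toℕ p) ⌋

nextMod-inner : ∀ {n p} → suc p < n → nextMod n p ≡ suc p
nextMod-inner {n} {p} 1+p<n with suc p ℕ.≟ n
... | yes 1+p≡n = contradiction 1+p≡n (ℕP.<⇒≢ 1+p<n)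
... | no _      = refl

Periodic : ℕ → (ℕ → ℤ) → Set
Periodic k f = ∀ p → f (k ℕ.+ p) ≡ f p

periodic-shift : ∀ {k f} → Periodic k f → ∀ t p → f (t ℕ.* k ℕ.+ p) ≡ f p
periodic-shift         per zero    p = refl
periodic-shift {k} {f} per (suc t) p =
  trans (cong f (ℕP.+-assoc k (t ℕ.* k) p)) (trans (per (t ℕ.* k ℕ.+ p)) (periodic-shift per t p))

∑-split : ∀ k m (f : ℕ → ℤ) →
          ∑[ i < k ℕ.+ m ] f (toℕ i) ≡ ∑[ i < k ] f (toℕ i) + ∑[ i < m ] f (k ℕ.+ toℕ i)
∑-split zero    m f = sym (ℤP.+-identityˡ _)
∑-split (suc k) m f = trans (cong (_+_ (f 0)) (∑-split k m (f ∘ suc)))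
                            (sym (ℤP.+-assoc (f 0) (∑[ i < k ] f (suc (toℕ i))) (∑[ i < m ] f (suc k ℕ.+ toℕ i))))

∑-periodic : ∀ {k f} → Periodic k f → ∑[ i < k ] f (toℕ i) ≡ + 0 →
             ∀ t → ∑[ i < t ℕ.* k ] f (toℕ i) ≡ + 0
∑-periodic         per period-sum zero    = refl
∑-periodic {k} {f} per period-sum (suc t) = begin
  ∑[ i < k ℕ.+ t ℕ.* k ] f (toℕ i)                             ≡⟨ ∑-split k (t ℕ.* k) f ⟩
  ∑[ i < k ] f (toℕ i) + ∑[ i < t ℕ.* k ] f (k ℕ.+ toℕ i)
    ≡⟨ cong₂ _+_ period-sum (sum-cong-≗ {t ℕ.* k} (λ i → per (toℕ i))) ⟩
  + 0 + ∑[ i < t ℕ.* k ] f (toℕ i)                             ≡⟨ cong (_+_ (+ 0)) (∑-periodic per period-sum t) ⟩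
  + 0                                                           ∎
  where open ≡-Reasoning

cycleMat-*ᵥ-periodic : ∀ {n t} → n ≡ suc t ℕ.* 4 → ∀ {f} → Periodic 4 f → ∀ p →
                       (cycleMat *ᵥ (f ∘ toℕ)) p ≡ f (suc (toℕ p)) + f (3 ℕ.+ toℕ p)
cycleMat-*ᵥ-periodic {n} {t} n≡ {f} per p =
  trans (cycleMat-*ᵥ 3≤n f p) (cong₂ _+_ (next (toℕ p)) (prev (toℕ p)))
  where
  3≤n : 3 ≤ n
  3≤n = subst (3 ≤_) (sym n≡) (s≤s (s≤s (s≤s z≤n)))
  next : ∀ p → f (nextMod n p) ≡ f (suc p)
  next p with suc p ℕ.≟ n
  ... | yes 1+p≡n = sym (trans (cong f (trans 1+p≡n n≡))
                              (trans (cong f (sym (ℕP.+-identityʳ _))) (periodic-shift per (suc t) 0)))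
  ... | no _      = refl
  prev : ∀ p → f (prevMod n p) ≡ f (3 ℕ.+ p)
  prev zero    = trans (cong (λ m → f (m ∸ 1)) n≡) (trans (cong f (ℕP.+-comm 3 (t ℕ.* 4))) (periodic-shift per t 3))
  prev (suc p) = sym (per p)

-- Second-order recurrences along the cycle

alternating : ℕ → ℤ
alternating zero          = + 1
alternating (suc zero)    = - + 1
alternating (suc (suc p)) = alternating p

cos-quarter : ℕ → ℤ
cos-quarter 0 = + 1
cos-quarter 1 = + 0
cos-quarter 2 = - + 1
cos-quarter 3 = + 0
cos-quarter (suc (suc (suc (suc p)))) = cos-quarter p

sin-quarter : ℕ → ℤ
sin-quarter 0 = + 0
sin-quarter 1 = + 1
sin-quarter 2 = + 0
sin-quarter 3 = - + 1
sin-quarter (suc (suc (suc (suc p)))) = sin-quarter p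

Recurrence : ℤ → (ℕ → ℤ) → ℕ → Set
Recurrence c f N = ∀ p → suc (suc p) < N → f (suc (suc p)) + f p ≡ c * f (suc p)

agree-below : ∀ {N} (f g : ℕ → ℤ) → f 0 ≡ g 0 → f 1 ≡ g 1 →
  (∀ p → suc (suc p) < N → f p ≡ g p → f (suc p) ≡ g (suc p) → f (suc (suc p)) ≡ g (suc (suc p))) →
  ∀ p → p < N → f p ≡ g p
agree-below {N} f g f₀ f₁ step zero    _   = f₀
agree-below {N} f g f₀ f₁ step (suc p) p<N = proj₂ (pairs p p<N)
  where
  pairs : ∀ p → suc p < N → f p ≡ g p × f (suc p) ≡ g (suc p)
  pairs zero    _     = f₀ , f₁
  pairs (suc p) 2+p<N = let (e₀ , e₁) = pairs p (ℕP.<-trans (ℕP.n<1+n (suc p)) 2+p<N) in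
    e₁ , step p 2+p<N e₀ e₁

cos-quarter-2+ : ∀ p → cos-quarter (suc (suc p)) ≡ - cos-quarter p
cos-quarter-2+ 0 = refl
cos-quarter-2+ 1 = refl
cos-quarter-2+ 2 = refl
cos-quarter-2+ 3 = refl
cos-quarter-2+ (suc (suc (suc (suc p)))) = cos-quarter-2+ p

sin-quarter-2+ : ∀ p → sin-quarter (suc (suc p)) ≡ - sin-quarter p
sin-quarter-2+ 0 = refl
sin-quarter-2+ 1 = refl
sin-quarter-2+ 2 = refl
sin-quarter-2+ 3 = refl
sin-quarter-2+ (suc (suc (suc (suc p)))) = sin-quarter-2+ p

alternating-suc : ∀ p → alternating (suc p) ≡ - alternating p
alternating-suc zero          = refl
alternating-suc (suc zero)    = refl
alternating-suc (suc (suc p)) = alternating-suc p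

alternating-odd : ∀ k → alternating (suc (k ℕ.* 2)) ≡ - + 1
alternating-odd zero    = refl
alternating-odd (suc k) = alternating-odd k

alternating² : ∀ p → alternating p * alternating p ≡ + 1
alternating² zero          = refl
alternating² (suc zero)    = refl
alternating² (suc (suc p)) = alternating² p

kernel-solution : ∀ {N f} → Recurrence (+ 0) f N → ∀ p → p < N → f p ≡ f 0 * cos-quarter p + f 1 * sin-quarter p
kernel-solution {N} {f} rec = agree-below f (λ p → f 0 * cos-quarter p + f 1 * sin-quarter p)
  (pick₀ (f 0) (f 1)) (pick₁ (f 0) (f 1)) step
  where
  pick₀ : ∀ a b → a ≡ a * + 1 + b * + 0
  pick₀ = solve-∀
  pick₁ : ∀ a b → b ≡ a * + 0 + b * + 1
  pick₁ = solve-∀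
  negate : ∀ a b c s → a * - c + b * - s ≡ - (a * c + b * s)
  negate = solve-∀
  step : ∀ p → suc (suc p) < N →
         f p ≡ f 0 * cos-quarter p + f 1 * sin-quarter p →
         f (suc p) ≡ f 0 * cos-quarter (suc p) + f 1 * sin-quarter (suc p) →
         f (suc (suc p)) ≡ f 0 * cos-quarter (suc (suc p)) + f 1 * sin-quarter (suc (suc p))
  step p 2+p<N fₚ _ = begin
    f (suc (suc p))
      ≡⟨ inverseˡ-unique (f (suc (suc p))) (f p) (trans (rec p 2+p<N) (ℤP.*-zeroˡ (f (suc p)))) ⟩
    - f p                                ≡⟨ cong -_ fₚ ⟩
    - (f 0 * cos-quarter p + f 1 * sin-quarter p)
      ≡⟨ negate (f 0) (f 1) (cos-quarter p) (sin-quarter p) ⟨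
    f 0 * - cos-quarter p + f 1 * - sin-quarter p
      ≡⟨ cong₂ (λ c s → f 0 * c + f 1 * s) (cos-quarter-2+ p) (sin-quarter-2+ p) ⟨
    f 0 * cos-quarter (suc (suc p)) + f 1 * sin-quarter (suc (suc p)) ∎
    where open ≡-Reasoning

linear-solution : ∀ {N} (r : ℕ → ℤ) → (∀ p → suc (suc p) < N → r (suc (suc p)) ≡ + 2 * r (suc p) - r p) →
                  ∀ p → p < N → r p ≡ r 0 + + p * (r 1 - r 0)
linear-solution {N} r rec = agree-below r (λ p → r 0 + + p * (r 1 - r 0))
  (start₀ (r 0) (r 1)) (start₁ (r 0) (r 1)) step
  where
  start₀ : ∀ a b → a ≡ a + + 0 * (b - a)
  start₀ = solve-∀
  start₁ : ∀ a b → b ≡ a + + 1 * (b - a)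
  start₁ = solve-∀
  extrapolate : ∀ a d p → + 2 * (a + (+ 1 + p) * d) - (a + p * d) ≡ a + (+ 2 + p) * d
  extrapolate = solve-∀
  step : ∀ p → suc (suc p) < N → r p ≡ r 0 + + p * (r 1 - r 0) → r (suc p) ≡ r 0 + + suc p * (r 1 - r 0) →
         r (suc (suc p)) ≡ r 0 + + suc (suc p) * (r 1 - r 0)
  step p 2+p<N rₚ r₁₊ₚ = trans (rec p 2+p<N) (trans (cong₂ (λ a b → + 2 * a - b) r₁₊ₚ rₚ)
                                                    (extrapolate (r 0) (r 1 - r 0) (+ p)))

alternating-twist : ∀ {N f} → Recurrence (- + 2) f N → ∀ p → suc (suc p) < N →
  alternating (suc (suc p)) * f (suc (suc p)) ≡ + 2 * (alternating (suc p) * f (suc p)) - alternating p * f p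
alternating-twist {N} {f} rec p 2+p<N = begin
  alternating p * f (suc (suc p))
    ≡⟨ cong (alternating p *_) (x≈z//y (f (suc (suc p))) (f p) _ (rec p 2+p<N)) ⟩
  alternating p * (- + 2 * f (suc p) - f p)
    ≡⟨ distribute (alternating p) (f (suc p)) (f p) ⟩
  + 2 * (- alternating p * f (suc p)) - alternating p * f p
    ≡⟨ cong (λ a → + 2 * (a * f (suc p)) - alternating p * f p) (alternating-suc p) ⟨
  + 2 * (alternating (suc p) * f (suc p)) - alternating p * f p ∎
  where
  open ≡-Reasoning
  distribute : ∀ s a b → s * (- + 2 * a - b) ≡ + 2 * (- s * a) - s * b
  distribute = solve-∀

alternating-solution : ∀ {n k f} → n ≡ suc k ℕ.* 2 → Recurrence (- + 2) f n → f 1 + f (n ∸ 1) ≡ - + 2 * f 0 →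
                       ∀ p → p < n → f p ≡ alternating p * f 0
alternating-solution {n} {k} {f} refl rec wrap p p<n = begin
  f p                  ≡⟨ unsign ⟨
  alternating p * r p  ≡⟨ cong (alternating p *_) (trans (linear p p<n) flat) ⟩
  alternating p * r 0  ≡⟨ cong (alternating p *_) (ℤP.*-identityˡ (f 0)) ⟩
  alternating p * f 0  ∎
  where
  open ≡-Reasoning
  r : ℕ → ℤ
  r p = alternating p * f p
  linear : ∀ p → p < n → r p ≡ r 0 + + p * (r 1 - r 0)
  linear = linear-solution r (alternating-twist rec)
  unsign : alternating p * r p ≡ f p
  unsign = trans (sym (ℤP.*-assoc (alternating p) (alternating p) (f p)))
                 (trans (cong (_* f p) (alternating² p)) (ℤP.*-identityˡ (f p)))
  P : ℕ
  P = suc (k ℕ.* 2)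
  r-wrap : r 1 + r P ≡ + 2 * r 0
  r-wrap = begin
    r 1 + r P        ≡⟨ cong₂ _+_ (ℤP.-1*i≡-i (f 1))
                                  (trans (cong (_* f P) (alternating-odd k)) (ℤP.-1*i≡-i (f P))) ⟩
    - f 1 + - f P    ≡⟨ ℤP.neg-distrib-+ (f 1) (f P) ⟨
    - (f 1 + f P)    ≡⟨ cong -_ wrap ⟩
    - (- + 2 * f 0)  ≡⟨ negate (f 0) ⟩
    + 2 * r 0        ∎
    where
    negate : ∀ a → - (- + 2 * a) ≡ + 2 * (+ 1 * a)
    negate = solve-∀
  slope-vanishes : ∀ a b P → b + (a + P * (b - a)) ≡ + 2 * a → (+ 1 + P) * (b - a) ≡ + 0
  slope-vanishes a b P closes = trans (expand a b P) (trans (cong (_- + 2 * a) closes) (ℤP.+-inverseʳ (+ 2 * a)))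
    where
    expand : ∀ a b P → (+ 1 + P) * (b - a) ≡ b + (a + P * (b - a)) - + 2 * a
    expand = solve-∀
  slope≡0 : r 1 - r 0 ≡ + 0
  slope≡0 = ℤP.*-cancelˡ-≡ (+ suc P) (r 1 - r 0) (+ 0)
    (trans (slope-vanishes (r 0) (r 1) (+ P) (trans (cong (_+_ (r 1)) (sym (linear P ℕP.≤-refl))) r-wrap))
           (sym (ℤP.*-zeroʳ (+ suc P))))
  flat : r 0 + + p * (r 1 - r 0) ≡ r 0
  flat = trans (cong (λ d → r 0 + + p * d) slope≡0)
               (trans (cong (_+_ (r 0)) (ℤP.*-zeroʳ (+ p))) (ℤP.+-identityʳ (r 0)))

-- Junk value 0 past the end of the vector.
toSeq : ∀ {n} → Vector ℤ n → ℕ → ℤ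
toSeq {n} z p with p ℕ.<? n
... | yes p<n = z (Fin.fromℕ< p<n)
... | no _    = + 0

toSeq-toℕ : ∀ {n} (z : Vector ℤ n) q → toSeq z (toℕ q) ≡ z q
toSeq-toℕ {n} z q with toℕ q ℕ.<? n
... | yes q<n = cong z (FinP.fromℕ<-toℕ q q<n)
... | no q≮n  = contradiction (FinP.toℕ<n q) q≮n

module _ {n} (3≤n : 3 ≤ n) {z : Vector ℤ n} {c} (eigen : cycleMat *ᵥ z ≗ (λ q → c * z q)) where

  cycle-eigen-at : ∀ p → p < n → toSeq z (nextMod n p) + toSeq z (prevMod n p) ≡ c * toSeq z p
  cycle-eigen-at p p<n = subst (λ p → toSeq z (nextMod n p) + toSeq z (prevMod n p) ≡ c * toSeq z p)
                               (FinP.toℕ-fromℕ< p<n) (at (Fin.fromℕ< p<n))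
    where
    at : ∀ q → toSeq z (nextMod n (toℕ q)) + toSeq z (prevMod n (toℕ q)) ≡ c * toSeq z (toℕ q)
    at q = begin
      toSeq z (nextMod n (toℕ q)) + toSeq z (prevMod n (toℕ q)) ≡⟨ cycleMat-*ᵥ 3≤n (toSeq z) q ⟨
      (cycleMat *ᵥ (toSeq z ∘ toℕ)) q                           ≡⟨ *ᵥ-congʳ cycleMat (toSeq-toℕ z) q ⟩
      (cycleMat *ᵥ z) q                                         ≡⟨ eigen q ⟩
      c * z q                                                   ≡⟨ cong (c *_) (toSeq-toℕ z q) ⟨
      c * toSeq z (toℕ q)                                       ∎
      where open ≡-Reasoning

  cycle-eigen-recurrence : Recurrence c (toSeq z) n
  cycle-eigen-recurrence p 2+p<n =
    trans (cong (λ i → toSeq z i + toSeq z p) (sym (nextMod-inner 2+p<n)))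
          (cycle-eigen-at (suc p) (ℕP.<-trans (ℕP.n<1+n (suc p)) 2+p<n))

  cycle-eigen-wrap : toSeq z 1 + toSeq z (n ∸ 1) ≡ c * toSeq z 0
  cycle-eigen-wrap = trans (cong (λ i → toSeq z i + toSeq z (n ∸ 1)) (sym (nextMod-inner 1<n)))
                           (cycle-eigen-at 0 (ℕP.<-trans (s≤s z≤n) 1<n))
    where
    1<n : 1 < n
    1<n = ℕP.<-≤-trans (s≤s (s≤s z≤n)) 3≤n

  cycle-kernel : c ≡ + 0 → ∀ q → z q ≡ toSeq z 0 * cos-quarter (toℕ q) + toSeq z 1 * sin-quarter (toℕ q)
  cycle-kernel refl q = trans (sym (toSeq-toℕ z q))
    (kernel-solution {n} {toSeq z} cycle-eigen-recurrence (toℕ q) (FinP.toℕ<n q))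

  cycle-alternating : c ≡ - + 2 → ∀ {k} → n ≡ suc k ℕ.* 2 → ∀ q → z q ≡ alternating (toℕ q) * toSeq z 0
  cycle-alternating refl {k} n≡ q = trans (sym (toSeq-toℕ z q))
    (alternating-solution {n} {k} {toSeq z} n≡ cycle-eigen-recurrence cycle-eigen-wrap (toℕ q) (FinP.toℕ<n q))

alternating-neighbours : ∀ p → alternating (suc p) + alternating (3 ℕ.+ p) ≡ - + 2 * alternating p
alternating-neighbours zero          = refl
alternating-neighbours (suc zero)    = refl
alternating-neighbours (suc (suc p)) = alternating-neighbours p

cos-quarter-neighbours : ∀ p → cos-quarter (suc p) + cos-quarter (3 ℕ.+ p) ≡ + 0
cos-quarter-neighbours 0 = refl
cos-quarter-neighbours 1 = refl
cos-quarter-neighbours 2 = refl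
cos-quarter-neighbours 3 = refl
cos-quarter-neighbours (suc (suc (suc (suc p)))) = cos-quarter-neighbours p

sin-quarter-neighbours : ∀ p → sin-quarter (suc p) + sin-quarter (3 ℕ.+ p) ≡ + 0
sin-quarter-neighbours 0 = refl
sin-quarter-neighbours 1 = refl
sin-quarter-neighbours 2 = refl
sin-quarter-neighbours 3 = refl
sin-quarter-neighbours (suc (suc (suc (suc p)))) = sin-quarter-neighbours p

at-2-mod-4 : ℕ → ℤ
at-2-mod-4 2 = + 1
at-2-mod-4 (suc (suc (suc (suc p)))) = at-2-mod-4 p
at-2-mod-4 _ = + 0

at-3-mod-4 : ℕ → ℤ
at-3-mod-4 3 = + 1
at-3-mod-4 (suc (suc (suc (suc p)))) = at-3-mod-4 p
at-3-mod-4 _ = + 0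

twice-cos-quarter : ∀ p → + 2 * cos-quarter p ≡ + 1 + + 1 * alternating p - + 4 * at-2-mod-4 p
twice-cos-quarter 0 = refl
twice-cos-quarter 1 = refl
twice-cos-quarter 2 = refl
twice-cos-quarter 3 = refl
twice-cos-quarter (suc (suc (suc (suc p)))) = twice-cos-quarter p

twice-sin-quarter : ∀ p → + 2 * sin-quarter p ≡ + 1 + - + 1 * alternating p - + 4 * at-3-mod-4 p
twice-sin-quarter 0 = refl
twice-sin-quarter 1 = refl
twice-sin-quarter 2 = refl
twice-sin-quarter 3 = refl
twice-sin-quarter (suc (suc (suc (suc p)))) = twice-sin-quarter p

-- Congruences for G_{3,m}

infix 4 _≡[mod_]_

record _≡[mod_]_ (x k r : ℤ) : Set where
  constructor residue
  field
    divides-difference : k ∣ x - r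

mod-intro : ∀ {x k r} q → x ≡ r + q * k → x ≡[mod k ] r
mod-intro {x} {k} {r} q x≡ = residue (divides q (trans (cong (_- r) x≡) (cancel r (q * k))))
  where
  cancel : ∀ r t → r + t - r ≡ t
  cancel = solve-∀

mod-elim : ∀ {x k r} → x ≡[mod k ] r → ∃ λ q → x ≡ r + q * k
mod-elim {x} {k} {r} (residue (divides q x-r≡)) = q , trans (restore x r) (cong (_+_ r) x-r≡)
  where
  restore : ∀ x r → x ≡ r + (x - r)
  restore = solve-∀

mod-sym : ∀ {x k r} → x ≡[mod k ] r → r ≡[mod k ] x
mod-sym {x} {k} {r} (residue k∣x-r) = residue (subst (k ∣_) (flip x r) (∣m⇒∣-m k∣x-r))
  where
  flip : ∀ x r → - (x - r) ≡ r - x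
  flip = solve-∀

residue-absurd : ∀ {x y r k} → x ≡[mod k ] r → x ≡ y → False (k ∣? y - r) → ⊥
residue-absurd (residue k∣x-r) refl k∤y-r = toWitnessFalse k∤y-r k∣x-r

module _ (d : ℕ) (k x r : ℤ) (fixed : x * r - + (d ∸ 1) * r ≡[mod k ] r) where

  G-residue-step : ∀ j → G d j x ≡[mod k ] r → G d (suc j) x ≡[mod k ] r →
                   G d (suc (suc j)) x ≡[mod k ] r
  G-residue-step j (residue h₀) (residue h₁) = residue (subst (k ∣_) (split x r (+ (d ∸ 1)) (G d (suc j) x) (G d j x))
    (∣m∣n⇒∣m+n (∣m∣n⇒∣m-n (∣n⇒∣m*n x h₁) (∣n⇒∣m*n (+ (d ∸ 1)) h₀))
               (_≡[mod_]_.divides-difference fixed)))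
    where
    split : ∀ x r c g₁ g₀ → x * (g₁ - r) - c * (g₀ - r) + (x * r - c * r - r) ≡ x * g₁ - c * g₀ - r
    split = solve-∀

  G-residue-stable : ∀ j → G d j x ≡[mod k ] r → G d (suc j) x ≡[mod k ] r →
                     ∀ {i} → j ≤ i → G d i x ≡[mod k ] r
  G-residue-stable j h₀ h₁ {i} j≤i =
    subst (λ i → G d i x ≡[mod k ] r) (ℕP.m∸n+n≡m j≤i) (proj₁ (pairs (i ∸ j)))
    where
    pairs : ∀ t → G d (t ℕ.+ j) x ≡[mod k ] r × G d (suc (t ℕ.+ j)) x ≡[mod k ] r
    pairs zero    = h₀ , h₁
    pairs (suc t) = let (g₀ , g₁) = pairs t in g₁ , G-residue-step (t ℕ.+ j) g₀ g₁

data OddWithin3 : ℤ → Set where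
  odd+3 : OddWithin3 (+ 3)
  odd+1 : OddWithin3 (+ 1)
  odd-1 : OddWithin3 (- + 1)
  odd-3 : OddWithin3 (- + 3)

G-at-3-suc : ∀ m → G 3 (suc m) (+ 3) ≡ + 2 * G 3 m (+ 3) + + 2
G-at-3-suc zero    = refl
G-at-3-suc (suc m) = trans (cong (λ g → + 3 * g - + 2 * G 3 m (+ 3)) (G-at-3-suc m))
  (trans (collect (G 3 m (+ 3))) (cong (λ g → + 2 * g + + 2) (sym (G-at-3-suc m))))
  where
  collect : ∀ g → + 3 * (+ 2 * g + + 2) - + 2 * g ≡ + 2 * (+ 2 * g + + 2) + + 2
  collect = solve-∀

G-at-3-≥4 : ∀ m → ∃ λ k → G 3 (suc m) (+ 3) ≡ + 4 + + k
G-at-3-≥4 zero    = 0 , refl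
G-at-3-≥4 (suc m) = let (k , eq) = G-at-3-≥4 m in
  6 ℕ.+ k ℕ.+ k , trans (G-at-3-suc (suc m)) (trans (cong (λ g → + 2 * g + + 2) eq) (double k))
  where
  collect : ∀ k → + 2 * (+ 4 + k) + + 2 ≡ + 4 + (+ 6 + k + k)
  collect = solve-∀
  double : ∀ k → + 2 * (+ 4 + + k) + + 2 ≡ + 4 + + (6 ℕ.+ k ℕ.+ k)
  double k = trans (collect (+ k)) (cong (_+_ (+ 4))
    (sym (trans (ℤP.pos-+ (6 ℕ.+ k) k) (cong (_+ + k) (ℤP.pos-+ 6 k)))))

G-at-3-mod4 : ∀ {m} → 2 ≤ m → G 3 m (+ 3) ≡[mod + 4 ] + 2
G-at-3-mod4 = G-residue-stable 3 (+ 4) (+ 3) (+ 2) (mod-intro (+ 0) refl)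
              2 (mod-intro (+ 2) refl) (mod-intro (+ 5) refl)

G-at-1-mod4 : ∀ {m} → 2 ≤ m → G 3 m (+ 1) ≡[mod + 4 ] + 0
G-at-1-mod4 = G-residue-stable 3 (+ 4) (+ 1) (+ 0) (mod-intro (+ 0) refl)
              2 (mod-intro (+ 0) refl) (mod-intro (- + 1) refl)

G-at-1-mod8 : ∀ {m} → 3 ≤ m → G 3 m (+ 1) ≡[mod + 8 ] + 4
G-at-1-mod8 = G-residue-stable 3 (+ 8) (+ 1) (+ 4) (mod-intro (- + 1) refl)
              3 (mod-intro (- + 1) refl) (mod-intro (- + 1) refl)

G-at-−1-mod8 : ∀ {m} → 3 ≤ m → G 3 m (- + 1) ≡[mod + 8 ] + 2
G-at-−1-mod8 = G-residue-stable 3 (+ 8) (- + 1) (+ 2) (mod-intro (- + 1) refl)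
               3 (mod-intro (+ 0) refl) (mod-intro (+ 0) refl)

G-at-−3-mod4 : ∀ {m} → 2 ≤ m → G 3 m (- + 3) ≡[mod + 4 ] + 0
G-at-−3-mod4 = G-residue-stable 3 (+ 4) (- + 3) (+ 0) (mod-intro (+ 0) refl)
               2 (mod-intro (+ 1) refl) (mod-intro (- + 2) refl)

G-at-−3-suc : ∀ m → G 3 (suc m) (- + 3) ≡ - + 2 * G 3 m (- + 3)
G-at-−3-suc zero    = refl
G-at-−3-suc (suc m) = trans (cong (λ g → - + 3 * g - + 2 * G 3 m (- + 3)) (G-at-−3-suc m))
  (trans (collect (G 3 m (- + 3))) (cong (- + 2 *_) (sym (G-at-−3-suc m))))
  where
  collect : ∀ g → - + 3 * (- + 2 * g) - + 2 * g ≡ - + 2 * (- + 2 * g)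
  collect = solve-∀

G-at-−3-nonzero : ∀ m → G 3 m (- + 3) ≢ + 0
G-at-−3-nonzero zero ()
G-at-−3-nonzero (suc m) eq with ℤP.i*j≡0⇒i≡0∨j≡0 (- + 2) (trans (sym (G-at-−3-suc m)) eq)
... | inj₂ eq′ = G-at-−3-nonzero m eq′

G-odd-≢-2 : ∀ {m μ} → 3 ≤ m → OddWithin3 μ → G 3 m μ ≢ - + 2
G-odd-≢-2 {suc m} _ odd+3 eq with G-at-3-≥4 m
... | k , eq′ with () ← trans (sym eq′) eq
G-odd-≢-2 3≤m odd+1 eq = residue-absurd (G-at-1-mod4 (ℕP.≤-trans (ℕP.n≤1+n 2) 3≤m)) eq _
G-odd-≢-2 3≤m odd-1 eq = residue-absurd (G-at-−1-mod8 3≤m) eq _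
G-odd-≢-2 3≤m odd-3 eq = residue-absurd (G-at-−3-mod4 (ℕP.≤-trans (ℕP.n≤1+n 2) 3≤m)) eq _

G-odd-≡2 : ∀ {m μ} → 2 ≤ m → OddWithin3 μ → G 3 m μ ≡ + 2 → μ ≡ - + 1 × 3 ≤ m
G-odd-≡2 {suc m} _ odd+3 eq with G-at-3-≥4 m
... | k , eq′ with () ← trans (sym eq′) eq
G-odd-≡2 2≤m odd+1 eq = ⊥-elim (residue-absurd (G-at-1-mod4 2≤m) eq _)
G-odd-≡2 2≤m odd-3 eq = ⊥-elim (residue-absurd (G-at-−3-mod4 2≤m) eq _)
G-odd-≡2 {suc (suc (suc m))} _ odd-1 eq = refl , s≤s (s≤s (s≤s z≤n))

G-odd-≢0 : ∀ {m μ} → 3 ≤ m → OddWithin3 μ → G 3 m μ ≢ + 0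
G-odd-≢0 {suc m} _ odd+3 eq with G-at-3-≥4 m
... | k , eq′ with () ← trans (sym eq′) eq
G-odd-≢0 3≤m odd+1 eq = residue-absurd (G-at-1-mod8 3≤m) eq _
G-odd-≢0 3≤m odd-1 eq = residue-absurd (G-at-−1-mod8 3≤m) eq _
G-odd-≢0 {m} _ odd-3 eq = G-at-−3-nonzero m eq

mat₂ : ℤ → ℤ → ℤ → ℤ → Mat 2
mat₂ a b′ b e 0F 0F = a
mat₂ a b′ b e 0F 1F = b′
mat₂ a b′ b e 1F 0F = b
mat₂ a b′ b e 1F 1F = e

mat₂-parity-step : ∀ {a b′ b e g₀ g₁ h₀ h₁} →
  b′ ≡[mod + 2 ] + 0 → b ≡[mod + 2 ] + 0 → e ≡[mod + 2 ] + 1 →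
  g₁ ≡[mod + 2 ] + 0 → h₀ ≡[mod + 2 ] + 0 → h₁ ≡[mod + 4 ] b →
  h₁ ≡[mod + 2 ] + 0 ×
  a * h₀ + b′ * h₁ - + 2 * g₀ ≡[mod + 2 ] + 0 ×
  b * h₀ + e * h₁ - + 2 * g₁ ≡[mod + 4 ] b
mat₂-parity-step {a} {g₀ = g₀} b′-even b-even e-odd g₁-even h₀-even h₁≡b
  with β′ , refl ← mod-elim b′-even | β , refl ← mod-elim b-even | ε , refl ← mod-elim e-odd
     | x , refl ← mod-elim g₁-even | y , refl ← mod-elim h₀-even | z , refl ← mod-elim h₁≡b =
  mod-intro (β + z * + 2) (even β z) ,
  mod-intro (a * y + β′ * (+ 0 + β * + 2 + z * + 4) - g₀) (diagonal a β′ β y z g₀) ,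
  mod-intro (β * y + ε * β + (+ 1 + ε * + 2) * z - x) (off-diagonal β ε x y z)
  where
  even : ∀ β z → + 0 + β * + 2 + z * + 4 ≡ + 0 + (β + z * + 2) * + 2
  even = solve-∀
  diagonal : ∀ a β′ β y z g₀ →
    a * (+ 0 + y * + 2) + (+ 0 + β′ * + 2) * (+ 0 + β * + 2 + z * + 4) - + 2 * g₀
    ≡ + 0 + (a * y + β′ * (+ 0 + β * + 2 + z * + 4) - g₀) * + 2
  diagonal = solve-∀
  off-diagonal : ∀ β ε x y z →
    (+ 0 + β * + 2) * (+ 0 + y * + 2) + (+ 1 + ε * + 2) * (+ 0 + β * + 2 + z * + 4) - + 2 * (+ 0 + x * + 2)
    ≡ + 0 + β * + 2 + (β * y + ε * β + (+ 1 + ε * + 2) * z - x) * + 4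
  off-diagonal = solve-∀

Gpoly-mat₂-mod4 : ∀ {a b′ b e} →
                  a ≡[mod + 2 ] + 1 → b′ ≡[mod + 2 ] + 0 → b ≡[mod + 2 ] + 0 → e ≡[mod + 2 ] + 1 →
                  ∀ m → Gpoly 3 (mat₂ a b′ b e) (suc m) 1F 0F ≡[mod + 4 ] b
Gpoly-mat₂-mod4 {a} {b′} {b} {e} a-odd b′-even b-even e-odd m = proj₂ (proj₂ (invariant m))
  where
  G₀ G₁ : ℕ → ℤ
  G₀ k = Gpoly 3 (mat₂ a b′ b e) k 0F 0F
  G₁ k = Gpoly 3 (mat₂ a b′ b e) k 1F 0F
  drop-+0 : ∀ u v w → u + (v + + 0) - w ≡ u + v - w
  drop-+0 = solve-∀
  invariant : ∀ k → G₁ k ≡[mod + 2 ] + 0 × G₀ (suc k) ≡[mod + 2 ] + 0 × G₁ (suc k) ≡[mod + 4 ] b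
  invariant zero with α , refl ← mod-elim a-odd =
    mod-intro (+ 0) refl , mod-intro (+ 1 + α) (even α) , mod-intro (+ 0) (unchanged b)
    where
    even : ∀ α → + 1 + α * + 2 + + 1 ≡ + 0 + (+ 1 + α) * + 2
    even = solve-∀
    unchanged : ∀ b → b + + 0 ≡ b + + 0 * + 4
    unchanged = solve-∀
  invariant (suc k) =
    let (g₁-even , h₀-even , h₁≡b) = invariant k
        (h₁-even , diagonal , off-diagonal) =
          mat₂-parity-step {a} {g₀ = G₀ k} b′-even b-even e-odd g₁-even h₀-even h₁≡b
    in h₁-even ,
       subst (_≡[mod + 2 ] + 0) (sym (drop-+0 (a * G₀ (suc k)) (b′ * G₁ (suc k)) (+ 2 * G₀ k))) diagonal ,
       subst (_≡[mod + 4 ] b) (sym (drop-+0 (b * G₀ (suc k)) (e * G₁ (suc k)) (+ 2 * G₁ k))) off-diagonal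

-- A row of a cubic graph against a vector of signs

data Trit (v : ℤ) : Set where
  trit+1 : v ≡ + 1   → Trit v
  trit-1 : v ≡ - + 1 → Trit v
  trit0  : v ≡ + 0   → Trit v

record Tally {n} (b : Fin n → Bool) (y : Vector ℤ n) : Set where
  field
    plus minus zeros : ℕ
    total   : ∑[ q < n ] b2ℤ (b q) ≡ + plus + + minus + + zeros
    value   : ∑[ q < n ] (b2ℤ (b q) * y q) ≡ + plus - + minus
    nonzero : (∀ q → y q ≢ + 0) → zeros ≡ 0

cong-row : ∀ {x x′ y y′ v v′} → x ≡ x′ → y ≡ y′ → v ≡ v′ → b2ℤ x * y + v ≡ b2ℤ x′ * y′ + v′
cong-row refl refl refl = refl

tally-cons : ∀ {n} (b : Fin (suc n) → Bool) (y : Vector ℤ (suc n)) →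
             Trit (y Fin.zero) → Tally (b ∘ Fin.suc) (y ∘ Fin.suc) → Tally b y
tally-cons b y t T with b Fin.zero in b₀ | t
... | false | _ = record
  { plus = T.plus ; minus = T.minus ; zeros = T.zeros
  ; total   = trans (cong₂ (λ x s → b2ℤ x + s) b₀ T.total) (ℤP.+-identityˡ _)
  ; value   = trans (cong₂ (λ x v → b2ℤ x * y Fin.zero + v) b₀ T.value)
                    (trans (cong (_+ (+ T.plus - + T.minus)) (ℤP.*-zeroˡ (y Fin.zero))) (ℤP.+-identityˡ _))
  ; nonzero = λ y≢0 → T.nonzero (y≢0 ∘ Fin.suc) }
  where module T = Tally T
... | true | trit+1 y₀ = record
  { plus = suc T.plus ; minus = T.minus ; zeros = T.zeros
  ; total   = cong₂ (λ x s → b2ℤ x + s) b₀ T.total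
  ; value   = trans (cong-row b₀ y₀ T.value) (count (+ T.plus) (+ T.minus))
  ; nonzero = λ y≢0 → T.nonzero (y≢0 ∘ Fin.suc) }
  where
  module T = Tally T
  count : ∀ p m → + 1 * + 1 + (p - m) ≡ (+ 1 + p) - m
  count = solve-∀
... | true | trit-1 y₀ = record
  { plus = T.plus ; minus = suc T.minus ; zeros = T.zeros
  ; total   = trans (cong₂ (λ x s → b2ℤ x + s) b₀ T.total) (count-total (+ T.plus) (+ T.minus) (+ T.zeros))
  ; value   = trans (cong-row b₀ y₀ T.value) (count (+ T.plus) (+ T.minus))
  ; nonzero = λ y≢0 → T.nonzero (y≢0 ∘ Fin.suc) }
  where
  module T = Tally T
  count-total : ∀ p m z → + 1 + (p + m + z) ≡ p + (+ 1 + m) + z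
  count-total = solve-∀
  count : ∀ p m → + 1 * - + 1 + (p - m) ≡ p - (+ 1 + m)
  count = solve-∀
... | true | trit0 y₀ = record
  { plus = T.plus ; minus = T.minus ; zeros = suc T.zeros
  ; total   = trans (cong₂ (λ x s → b2ℤ x + s) b₀ T.total) (count-total (+ T.plus) (+ T.minus) (+ T.zeros))
  ; value   = trans (cong-row b₀ y₀ T.value) (ℤP.+-identityˡ _)
  ; nonzero = λ y≢0 → contradiction y₀ (y≢0 Fin.zero) }
  where
  module T = Tally T
  count-total : ∀ p m z → + 1 + (p + m + z) ≡ p + m + (+ 1 + z)
  count-total = solve-∀

tally : ∀ {n} (b : Fin n → Bool) (y : Vector ℤ n) → (∀ q → Trit (y q)) → Tally b y
tally {zero}  b y _    =
  record { plus = 0 ; minus = 0 ; zeros = 0 ; total = refl ; value = refl ; nonzero = λ _ → refl }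
tally {suc n} b y trit = tally-cons b y (trit Fin.zero) (tally (b ∘ Fin.suc) (y ∘ Fin.suc) (trit ∘ Fin.suc))

data Within3 : ℤ → Set where
  within+3 : Within3 (+ 3)
  within+2 : Within3 (+ 2)
  within+1 : Within3 (+ 1)
  within0  : Within3 (+ 0)
  within-1 : Within3 (- + 1)
  within-2 : Within3 (- + 2)
  within-3 : Within3 (- + 3)

difference-within3 : ∀ k l j → k ℕ.+ l ℕ.+ j ≡ 3 → Within3 (+ k - + l)
difference-within3 0 0 _ _ = within0
difference-within3 0 1 _ _ = within-1
difference-within3 0 2 _ _ = within-2
difference-within3 0 3 _ _ = within-3
difference-within3 0 (suc (suc (suc (suc _)))) _ ()
difference-within3 1 0 _ _ = within+1
difference-within3 1 1 _ _ = within0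
difference-within3 1 2 _ _ = within-1
difference-within3 1 (suc (suc (suc _))) _ ()
difference-within3 2 0 _ _ = within+2
difference-within3 2 1 _ _ = within+1
difference-within3 2 (suc (suc _)) _ ()
difference-within3 3 0 _ _ = within+3
difference-within3 3 (suc _) _ ()
difference-within3 (suc (suc (suc (suc _)))) _ _ ()

difference-odd : ∀ k l → k ℕ.+ l ≡ 3 → OddWithin3 (+ k - + l)
difference-odd 0 _ refl = odd-3
difference-odd 1 _ refl = odd-1
difference-odd 2 _ refl = odd+1
difference-odd 3 _ refl = odd+3
difference-odd (suc (suc (suc (suc _)))) _ ()

module _ {n} (b : Fin n → Bool) (three : ∑[ q < n ] b2ℤ (b q) ≡ + 3)
         {y : Vector ℤ n} (trit : ∀ q → Trit (y q)) where

  private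
    module T = Tally (tally b y trit)
    counts : T.plus ℕ.+ T.minus ℕ.+ T.zeros ≡ 3
    counts = ℤP.+-injective (trans (sym T.total) three)

  row-within3 : Within3 (∑[ q < n ] (b2ℤ (b q) * y q))
  row-within3 = subst Within3 (sym T.value) (difference-within3 T.plus T.minus T.zeros counts)

  row-odd : (∀ q → y q ≢ + 0) → OddWithin3 (∑[ q < n ] (b2ℤ (b q) * y q))
  row-odd y≢0 = subst OddWithin3 (sym T.value)
    (difference-odd T.plus T.minus (trans (sym (ℕP.+-identityʳ _))
                                          (subst (λ z → T.plus ℕ.+ T.minus ℕ.+ z ≡ 3) (T.nonzero y≢0) counts)))

within3-odd : ∀ {v} → Within3 v → v ≡[mod + 2 ] + 1 → OddWithin3 v
within3-odd within+3 _ = odd+3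
within3-odd within+1 _ = odd+1
within3-odd within-1 _ = odd-1
within3-odd within-3 _ = odd-3
within3-odd within+2 odd = ⊥-elim (residue-absurd odd refl _)
within3-odd within0  odd = ⊥-elim (residue-absurd odd refl _)
within3-odd within-2 odd = ⊥-elim (residue-absurd odd refl _)

within3-mod4 : ∀ {v} → Within3 v → v ≡[mod + 4 ] + 0 → v ≡ + 0
within3-mod4 within0  _  = refl
within3-mod4 within+3 v≡0 = ⊥-elim (residue-absurd v≡0 refl _)
within3-mod4 within+2 v≡0 = ⊥-elim (residue-absurd v≡0 refl _)
within3-mod4 within+1 v≡0 = ⊥-elim (residue-absurd v≡0 refl _)
within3-mod4 within-1 v≡0 = ⊥-elim (residue-absurd v≡0 refl _)
within3-mod4 within-2 v≡0 = ⊥-elim (residue-absurd v≡0 refl _)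
within3-mod4 within-3 v≡0 = ⊥-elim (residue-absurd v≡0 refl _)

alternating-trit : ∀ p → Trit (alternating p)
alternating-trit zero          = trit+1 refl
alternating-trit (suc zero)    = trit-1 refl
alternating-trit (suc (suc p)) = alternating-trit p

alternating≢0 : ∀ p → alternating p ≢ + 0
alternating≢0 zero          ()
alternating≢0 (suc zero)    ()
alternating≢0 (suc (suc p)) = alternating≢0 p

cos-quarter-trit : ∀ p → Trit (cos-quarter p)
cos-quarter-trit 0 = trit+1 refl
cos-quarter-trit 1 = trit0 refl
cos-quarter-trit 2 = trit-1 refl
cos-quarter-trit 3 = trit0 refl
cos-quarter-trit (suc (suc (suc (suc p)))) = cos-quarter-trit p

-- The equation G(A) = J + sB

relabel : ∀ {n} → Graph n → (Fin n → Fin n) → Graph n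
relabel Γ v = record
  { adj       = λ i j → adj Γ (v i) (v j)
  ; symmetric = λ i j → symmetric Γ (v i) (v j)
  ; loopless  = λ i → loopless Γ (v i)
  }

sumFin-b2ℕ : ∀ {n} (b : Fin n → Bool) → + sumFin ℕ._+_ 0 n (b2ℕ ∘ b) ≡ ∑[ j < n ] b2ℤ (b j)
sumFin-b2ℕ {zero}  b = refl
sumFin-b2ℕ {suc n} b =
  trans (ℤP.pos-+ (b2ℕ (b Fin.zero)) _) (cong₂ _+_ (b2ℤ-pos (b Fin.zero)) (sumFin-b2ℕ (b ∘ Fin.suc)))
  where
  b2ℤ-pos : ∀ x → + b2ℕ x ≡ b2ℤ x
  b2ℤ-pos true  = refl
  b2ℤ-pos false = refl

RowSums : ∀ {n} → Graph n → ℕ → Set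
RowSums {n} Γ d = ∀ i → ∑[ j < n ] adjMat Γ i j ≡ + d

regular⇒rowSums : ∀ {n d} {Γ : Graph n} → Regular d Γ → RowSums Γ d
regular⇒rowSums {Γ = Γ} regular i = trans (sym (sumFin-b2ℕ (adj Γ i))) (cong +_ (regular i))

relabel-rowSums : ∀ {n d} {Γ : Graph n} {v} → Injective _≡_ _≡_ v → RowSums Γ d → RowSums (relabel Γ v) d
relabel-rowSums {Γ = Γ} {v} v-injective rows i =
  trans (sym (∑-injective-reindex v v-injective (adjMat Γ (v i)))) (rows (v i))

data IsUnit : ℤ → Set where
  unit+1 : IsUnit (+ 1)
  unit-1 : IsUnit (- + 1)

cancel-unit : ∀ {s} → IsUnit s → ∀ u x y → u + s * x ≡ u + s * y → x ≡ y
cancel-unit unit+1 u x y eq = ℤP.*-cancelˡ-≡ (+ 1) x y (∙-cancelˡ u (+ 1 * x) (+ 1 * y) eq)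
cancel-unit unit-1 u x y eq = ℤP.*-cancelˡ-≡ (- + 1) x y (∙-cancelˡ u (- + 1 * x) (- + 1 * y) eq)

multiple-of-4 : ∀ {n} → 3 ≤ n → + n ≡[mod + 4 ] + 0 → ∃ λ t → n ≡ suc t ℕ.* 4
multiple-of-4 {n} 3≤n (residue 4∣n) with ∣⇒∣ᵤ 4∣n
... | ℕ∣.divides zero    n+0≡0 =
  contradiction (trans (sym (ℕP.+-identityʳ n)) n+0≡0) (ℕP.>⇒≢ (ℕP.<-≤-trans (s≤s z≤n) 3≤n))
... | ℕ∣.divides (suc t) n+0≡ = t , trans (sym (ℕP.+-identityʳ n)) n+0≡

module CycleEquation {n} (Γ : Graph n) (rows : RowSums Γ 3) (3≤n : 3 ≤ n)
                     {s} (s-unit : IsUnit s) {m} (2≤m : 2 ≤ m)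
                     (equation : ∀ p q → Gpoly 3 (adjMat Γ) m p q ≡ + 1 + s * cycleMat p q) where

  A : Mat n
  A = adjMat Γ

  Gpoly-*ᵥ-equation : ∀ y → Gpoly 3 A m *ᵥ y ≗ λ p → sum y + s * (cycleMat *ᵥ y) p
  Gpoly-*ᵥ-equation y p = begin
    ∑[ q < n ] (Gpoly 3 A m p q * y q)
      ≡⟨ sum-cong-≗ (λ q → trans (cong (_* y q) (equation p q)) (split s (cycleMat p q) (y q))) ⟩
    ∑[ q < n ] (y q + s * (cycleMat p q * y q))
      ≡⟨ ∑-distrib-+ y (λ q → s * (cycleMat p q * y q)) ⟩
    sum y + ∑[ q < n ] (s * (cycleMat p q * y q))
      ≡⟨ cong (_+_ (sum y)) (∑-distrib-* s (λ q → cycleMat p q * y q)) ⟩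
    sum y + s * (cycleMat *ᵥ y) p ∎
    where
    open ≡-Reasoning
    split : ∀ s c y → (+ 1 + s * c) * y ≡ y + s * (c * y)
    split = solve-∀

  A-*ᵥ-const : ∀ c → A *ᵥ (λ _ → c) ≗ λ _ → + 3 * c
  A-*ᵥ-const c p = trans (sym (*-distribʳ-sum c (A p))) (cong (_* c) (rows p)) 

  ∑-A-*ᵥ : ∀ y → sum (A *ᵥ y) ≡ + 3 * sum y
  ∑-A-*ᵥ y = begin
    ∑[ p < n ] ∑[ q < n ] (A p q * y q)   ≡⟨ ∑-comm (λ p q → A p q * y q) ⟩
    ∑[ q < n ] ∑[ p < n ] (A p q * y q)   ≡⟨ sum-cong-≗ column ⟩
    ∑[ q < n ] (+ 3 * y q)                ≡⟨ ∑-distrib-* (+ 3) y ⟩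
    + 3 * sum y                           ∎
    where
    open ≡-Reasoning
    column : ∀ q → ∑[ p < n ] (A p q * y q) ≡ + 3 * y q
    column q = trans (sym (*-distribʳ-sum (y q) (λ p → A p q)))
                     (cong (_* y q) (trans (sum-cong-≗ (λ p → cong b2ℤ (symmetric Γ p q))) (rows q)))

  cycleMat-A-comm : ∀ y → cycleMat *ᵥ (A *ᵥ y) ≗ A *ᵥ (cycleMat *ᵥ y)
  cycleMat-A-comm y p = cancel-unit s-unit (+ 3 * sum y) _ _ (begin
    + 3 * sum y + s * (cycleMat *ᵥ (A *ᵥ y)) p
      ≡⟨ cong (_+ s * (cycleMat *ᵥ (A *ᵥ y)) p) (∑-A-*ᵥ y) ⟨
    sum (A *ᵥ y) + s * (cycleMat *ᵥ (A *ᵥ y)) p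
      ≡⟨ Gpoly-*ᵥ-equation (A *ᵥ y) p ⟨
    (Gpoly 3 A m *ᵥ (A *ᵥ y)) p
      ≡⟨ Gpoly-*ᵥ-comm 3 A m y p ⟩
    (A *ᵥ (Gpoly 3 A m *ᵥ y)) p
      ≡⟨ *ᵥ-congʳ A (Gpoly-*ᵥ-equation y) p ⟩
    (A *ᵥ (λ q → sum y + s * (cycleMat *ᵥ y) q)) p
      ≡⟨ *ᵥ-+ A (λ _ → sum y) (λ q → s * (cycleMat *ᵥ y) q) p ⟩
    (A *ᵥ (λ _ → sum y)) p + (A *ᵥ (λ q → s * (cycleMat *ᵥ y) q)) p
      ≡⟨ cong₂ _+_ (A-*ᵥ-const (sum y) p) (*ᵥ-* A s (cycleMat *ᵥ y) p) ⟩
    + 3 * sum y + s * (A *ᵥ (cycleMat *ᵥ y)) p ∎)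
    where open ≡-Reasoning

  0<n : 0 < n
  0<n = ℕP.<-≤-trans (s≤s z≤n) 3≤n

  1<n : 1 < n
  1<n = ℕP.<-≤-trans (s≤s (s≤s z≤n)) 3≤n

  p₀ p₁ : Fin n
  p₀ = Fin.fromℕ< 0<n
  p₁ = Fin.fromℕ< 1<n

  toℕ-p₀ : toℕ p₀ ≡ 0
  toℕ-p₀ = FinP.toℕ-fromℕ< 0<n

  toℕ-p₁ : toℕ p₁ ≡ 1
  toℕ-p₁ = FinP.toℕ-fromℕ< 1<n

  toSeq-0 : ∀ z → toSeq z 0 ≡ z p₀
  toSeq-0 z = trans (cong (toSeq z) (sym toℕ-p₀)) (toSeq-toℕ z p₀)

  toSeq-1 : ∀ z → toSeq z 1 ≡ z p₁
  toSeq-1 z = trans (cong (toSeq z) (sym toℕ-p₁)) (toSeq-toℕ z p₁)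

  G-at-3≡n+2s : G 3 m (+ 3) ≡ + n + s * + 2
  G-at-3≡n+2s = begin
    G 3 m (+ 3)                          ≡⟨ ℤP.*-identityʳ _ ⟨
    G 3 m (+ 3) * + 1                    ≡⟨ Gpoly-*ᵥ-eigen 3 A (+ 3) (λ _ → + 1) (A-*ᵥ-const (+ 1)) m p₀ ⟨
    (Gpoly 3 A m *ᵥ (λ _ → + 1)) p₀      ≡⟨ Gpoly-*ᵥ-equation (λ _ → + 1) p₀ ⟩
    ∑[ q < n ] (+ 1) + s * (cycleMat *ᵥ (λ _ → + 1)) p₀
      ≡⟨ cong₂ (λ a b → a + s * b) (∑-const-1 n) (cycleMat-*ᵥ 3≤n (λ _ → + 1) p₀) ⟩
    + n + s * + 2                        ∎
    where open ≡-Reasoning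

  order-multiple-of-4 : ∃ λ t → n ≡ suc t ℕ.* 4
  order-multiple-of-4 =
    multiple-of-4 3≤n (n-mod4 s-unit (mod-elim (subst (_≡[mod + 4 ] + 2) G-at-3≡n+2s (G-at-3-mod4 2≤m))))
    where
    n-mod4 : ∀ {s} → IsUnit s → ∃ (λ q → + n + s * + 2 ≡ + 2 + q * + 4) → + n ≡[mod + 4 ] + 0
    n-mod4 {s} unit (q , eq) with unit | x≈z//y (+ n) (s * + 2) _ eq
    ... | unit+1 | n≡ = mod-intro q (trans n≡ (shift₊ q))
      where
      shift₊ : ∀ q → + 2 + q * + 4 - + 1 * + 2 ≡ + 0 + q * + 4
      shift₊ = solve-∀
    ... | unit-1 | n≡ = mod-intro (+ 1 + q) (trans n≡ (shift₋ q))
      where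
      shift₋ : ∀ q → + 2 + q * + 4 - - + 1 * + 2 ≡ + 0 + (+ 1 + q) * + 4
      shift₋ = solve-∀

  t : ℕ
  t = proj₁ order-multiple-of-4

  n≡4t : n ≡ suc t ℕ.* 4
  n≡4t = proj₂ order-multiple-of-4

  ∑-period-4 : ∀ {f} → Periodic 4 f → f 0 + (f 1 + (f 2 + (f 3 + + 0))) ≡ + 0 → ∑[ q < n ] f (toℕ q) ≡ + 0
  ∑-period-4 {f} per period-sum =
    subst (λ k → ∑[ q < k ] f (toℕ q) ≡ + 0) (sym n≡4t) (∑-periodic per period-sum (suc t))

  σ : Vector ℤ n
  σ q = alternating (toℕ q)

  cycleMat-σ : cycleMat *ᵥ σ ≗ λ q → - + 2 * σ q
  cycleMat-σ q = trans (cycleMat-*ᵥ-periodic {t = t} n≡4t {alternating} (λ _ → refl) q)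
                       (alternating-neighbours (toℕ q))

  σ-p₀ : σ p₀ ≡ + 1
  σ-p₀ = cong alternating toℕ-p₀

  μ : ℤ
  μ = toSeq (A *ᵥ σ) 0

  A-σ : A *ᵥ σ ≗ λ q → μ * σ q
  A-σ q = trans (cycle-alternating 3≤n Ax-eigen refl {suc (t ℕ.* 2)} n≡2k q) (ℤP.*-comm (σ q) μ)
    where
    Ax-eigen : cycleMat *ᵥ (A *ᵥ σ) ≗ λ q → - + 2 * (A *ᵥ σ) q
    Ax-eigen q = trans (cycleMat-A-comm σ q) (trans (*ᵥ-congʳ A cycleMat-σ q) (*ᵥ-* A (- + 2) σ q))
    n≡2k : n ≡ suc (suc (t ℕ.* 2)) ℕ.* 2
    n≡2k = trans n≡4t (double t)
      where
      double : ∀ t → suc t ℕ.* 4 ≡ suc (suc (t ℕ.* 2)) ℕ.* 2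
      double = ℕ-solve-∀

  μ-odd : OddWithin3 μ
  μ-odd = subst OddWithin3 (sym (toSeq-0 (A *ᵥ σ)))
            (row-odd (adj Γ p₀) (rows p₀) (alternating-trit ∘ toℕ) (alternating≢0 ∘ toℕ))

  G-μ : G 3 m μ ≡ s * - + 2
  G-μ = begin
    G 3 m μ                                  ≡⟨ trans (cong (G 3 m μ *_) σ-p₀) (ℤP.*-identityʳ _) ⟨
    G 3 m μ * σ p₀                           ≡⟨ Gpoly-*ᵥ-eigen 3 A μ σ A-σ m p₀ ⟨
    (Gpoly 3 A m *ᵥ σ) p₀                    ≡⟨ Gpoly-*ᵥ-equation σ p₀ ⟩
    sum σ + s * (cycleMat *ᵥ σ) p₀
      ≡⟨ cong₂ (λ a b → a + s * b) (∑-period-4 {alternating} (λ _ → refl) refl) (cycleMat-σ p₀) ⟩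
    + 0 + s * (- + 2 * σ p₀)                 ≡⟨ trans (ℤP.+-identityˡ _) (cong (λ v → s * (- + 2 * v)) σ-p₀) ⟩
    s * (- + 2 * + 1)                        ≡⟨ cong (s *_) (ℤP.*-identityʳ (- + 2)) ⟩
    s * - + 2                                ∎
    where open ≡-Reasoning

  defect-impossible : s ≡ + 1 → 3 ≤ m → ⊥
  defect-impossible s≡1 3≤m = G-odd-≢-2 3≤m μ-odd (trans G-μ (cong (_* - + 2) s≡1))

  module Excess (μ≡-1 : μ ≡ - + 1) (3≤m : 3 ≤ m) where

    U W : Vector ℤ n
    U q = cos-quarter (toℕ q)
    W q = sin-quarter (toℕ q)

    A-preserves-kernel : ∀ z → cycleMat *ᵥ z ≗ (λ q → + 0 * z q) →
                         cycleMat *ᵥ (A *ᵥ z) ≗ λ q → + 0 * (A *ᵥ z) q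
    A-preserves-kernel z kernel q = trans (cycleMat-A-comm z q) (trans (*ᵥ-congʳ A kernel q) (*ᵥ-* A (+ 0) z q))

    cycleMat-U : cycleMat *ᵥ U ≗ λ q → + 0 * U q
    cycleMat-U q = trans (cycleMat-*ᵥ-periodic {t = t} n≡4t {cos-quarter} (λ _ → refl) q)
                         (trans (cos-quarter-neighbours (toℕ q)) (sym (ℤP.*-zeroˡ (U q))))

    cycleMat-W : cycleMat *ᵥ W ≗ λ q → + 0 * W q
    cycleMat-W q = trans (cycleMat-*ᵥ-periodic {t = t} n≡4t {sin-quarter} (λ _ → refl) q)
                         (trans (sin-quarter-neighbours (toℕ q)) (sym (ℤP.*-zeroˡ (W q))))

    a b b′ e : ℤ
    a  = toSeq (A *ᵥ U) 0
    b  = toSeq (A *ᵥ U) 1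
    b′ = toSeq (A *ᵥ W) 0
    e  = toSeq (A *ᵥ W) 1

    A-U : A *ᵥ U ≗ λ q → a * U q + b * W q
    A-U = cycle-kernel 3≤n (A-preserves-kernel U cycleMat-U) refl

    A-W : A *ᵥ W ≗ λ q → b′ * U q + e * W q
    A-W = cycle-kernel 3≤n (A-preserves-kernel W cycleMat-W) refl

    -- With 2U = 1 + σ − 4·[p ≡ 2 mod 4], 2W = 1 − σ − 4·[p ≡ 3 mod 4], A1 = 3 and Aσ = −σ,
    -- this reads off the parities of the coefficients of AU and AW.
    parity : ∀ {f g ε} → (∀ p → + 2 * f p ≡ + 1 + ε * alternating p - + 4 * g p) →
             ∀ q r j → + 3 - ε * σ q ≡ + 2 * r + + 4 * j → (A *ᵥ (f ∘ toℕ)) q ≡[mod + 2 ] r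
    parity {f} {g} {ε} twice q r j 3-εx≡ = mod-intro (j - (A *ᵥ (g ∘ toℕ)) q) (ℤP.*-cancelˡ-≡ (+ 2) _ _ (begin
      + 2 * (A *ᵥ (f ∘ toℕ)) q
        ≡⟨ *ᵥ-* A (+ 2) (f ∘ toℕ) q ⟨
      (A *ᵥ (λ k → + 2 * f (toℕ k))) q
        ≡⟨ *ᵥ-congʳ A (twice ∘ toℕ) q ⟩
      (A *ᵥ (λ k → + 1 + ε * σ k - + 4 * g (toℕ k))) q
        ≡⟨ *ᵥ-- A (λ k → + 1 + ε * σ k) (λ k → + 4 * g (toℕ k)) q ⟩
      (A *ᵥ (λ k → + 1 + ε * σ k)) q - (A *ᵥ (λ k → + 4 * g (toℕ k))) q
        ≡⟨ cong₂ _-_ (*ᵥ-+ A (λ _ → + 1) (λ k → ε * σ k) q) (*ᵥ-* A (+ 4) (g ∘ toℕ) q) ⟩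
      (A *ᵥ (λ _ → + 1)) q + (A *ᵥ (λ k → ε * σ k)) q - + 4 * (A *ᵥ (g ∘ toℕ)) q
        ≡⟨ cong₂ (λ u v → u + v - + 4 * (A *ᵥ (g ∘ toℕ)) q) (A-*ᵥ-const (+ 1) q)
                 (trans (*ᵥ-* A ε σ q) (cong (ε *_) (trans (A-σ q) (cong (_* σ q) μ≡-1)))) ⟩
      + 3 * + 1 + ε * (- + 1 * σ q) - + 4 * (A *ᵥ (g ∘ toℕ)) q
        ≡⟨ rearrange ε (σ q) ((A *ᵥ (g ∘ toℕ)) q) ⟩
      + 3 - ε * σ q - + 4 * (A *ᵥ (g ∘ toℕ)) q
        ≡⟨ cong (λ u → u - + 4 * (A *ᵥ (g ∘ toℕ)) q) 3-εx≡ ⟩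
      + 2 * r + + 4 * j - + 4 * (A *ᵥ (g ∘ toℕ)) q
        ≡⟨ halve r j ((A *ᵥ (g ∘ toℕ)) q) ⟩
      + 2 * (r + (j - (A *ᵥ (g ∘ toℕ)) q) * + 2) ∎))
      where
      open ≡-Reasoning
      rearrange : ∀ ε x c → + 3 * + 1 + ε * (- + 1 * x) - + 4 * c ≡ + 3 - ε * x - + 4 * c
      rearrange = solve-∀
      halve : ∀ r j c → + 2 * r + + 4 * j - + 4 * c ≡ + 2 * (r + (j - c) * + 2)
      halve = solve-∀

    σ-p₁ : σ p₁ ≡ - + 1
    σ-p₁ = cong alternating toℕ-p₁

    parity-U : ∀ q r j → + 3 - + 1 * σ q ≡ + 2 * r + + 4 * j → (A *ᵥ U) q ≡[mod + 2 ] r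
    parity-U = parity {g = at-2-mod-4} {ε = + 1} twice-cos-quarter

    parity-W : ∀ q r j → + 3 - - + 1 * σ q ≡ + 2 * r + + 4 * j → (A *ᵥ W) q ≡[mod + 2 ] r
    parity-W = parity {g = at-3-mod-4} {ε = - + 1} twice-sin-quarter

    a-odd : a ≡[mod + 2 ] + 1
    a-odd = subst (_≡[mod + 2 ] + 1) (sym (toSeq-0 (A *ᵥ U)))
                  (parity-U p₀ (+ 1) (+ 0) (cong (λ v → + 3 - + 1 * v) σ-p₀))

    b-even : b ≡[mod + 2 ] + 0
    b-even = subst (_≡[mod + 2 ] + 0) (sym (toSeq-1 (A *ᵥ U)))
                   (parity-U p₁ (+ 0) (+ 1) (cong (λ v → + 3 - + 1 * v) σ-p₁))

    b′-even : b′ ≡[mod + 2 ] + 0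
    b′-even = subst (_≡[mod + 2 ] + 0) (sym (toSeq-0 (A *ᵥ W)))
                    (parity-W p₀ (+ 0) (+ 1) (cong (λ v → + 3 - - + 1 * v) σ-p₀))

    e-odd : e ≡[mod + 2 ] + 1
    e-odd = subst (_≡[mod + 2 ] + 1) (sym (toSeq-1 (A *ᵥ W)))
                  (parity-W p₁ (+ 1) (+ 0) (cong (λ v → + 3 - - + 1 * v) σ-p₁))

    Gpoly-U : Gpoly 3 A m *ᵥ U ≗ λ _ → + 0
    Gpoly-U q = begin
      (Gpoly 3 A m *ᵥ U) q               ≡⟨ Gpoly-*ᵥ-equation U q ⟩
      sum U + s * (cycleMat *ᵥ U) q
        ≡⟨ cong₂ (λ u v → u + s * v) (∑-period-4 {cos-quarter} (λ _ → refl) refl) (cycleMat-U q) ⟩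
      + 0 + s * (+ 0 * U q)              ≡⟨ vanish s (U q) ⟩
      + 0                                ∎
      where
      open ≡-Reasoning
      vanish : ∀ s u → + 0 + s * (+ 0 * u) ≡ + 0
      vanish = solve-∀

    -- The matrix of A on the plane spanned by U and W (see A-U and A-W).
    N : Mat 2
    N = mat₂ a b′ b e

    basis : Fin 2 → Vector ℤ n
    basis 0F = U
    basis 1F = W

    Gpoly-N-offdiagonal : Gpoly 3 N m 1F 0F ≡ + 0
    Gpoly-N-offdiagonal = begin
      Gpoly 3 N m 1F 0F
        ≡⟨ pick (Gpoly 3 N m 0F 0F) (Gpoly 3 N m 1F 0F) ⟩
      Gpoly 3 N m 0F 0F * + 0 + Gpoly 3 N m 1F 0F * + 1
        ≡⟨ cong₂ (λ u w → Gpoly 3 N m 0F 0F * u + Gpoly 3 N m 1F 0F * w)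
                 (cong cos-quarter toℕ-p₁) (cong sin-quarter toℕ-p₁) ⟨
      Gpoly 3 N m 0F 0F * U p₁ + Gpoly 3 N m 1F 0F * W p₁
        ≡⟨ Gpoly-*ᵥ-plane 3 A N basis invariant m 0F p₁ ⟨
      (Gpoly 3 A m *ᵥ U) p₁
        ≡⟨ Gpoly-U p₁ ⟩
      + 0 ∎
      where
      open ≡-Reasoning
      pick : ∀ g₀ g₁ → g₁ ≡ g₀ * + 0 + g₁ * + 1
      pick = solve-∀
      invariant : ∀ j → A *ᵥ basis j ≗ λ k → N 0F j * basis 0F k + N 1F j * basis 1F k
      invariant 0F = A-U
      invariant 1F = A-W

    b-within3 : Within3 b
    b-within3 = subst Within3 (sym (toSeq-1 (A *ᵥ U)))
                      (row-within3 (adj Γ p₁) (rows p₁) (cos-quarter-trit ∘ toℕ))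

    a-within3 : Within3 a
    a-within3 = subst Within3 (sym (toSeq-0 (A *ᵥ U)))
                      (row-within3 (adj Γ p₀) (rows p₀) (cos-quarter-trit ∘ toℕ))

    b≡0 : b ≡ + 0
    b≡0 = within3-mod4 b-within3 (mod-sym (subst (_≡[mod + 4 ] b) Gpoly-N-offdiagonal′
      (Gpoly-mat₂-mod4 a-odd b′-even b-even e-odd (ℕ.pred m))))
      where
      suc-pred : ∀ {k} → 3 ≤ k → suc (ℕ.pred k) ≡ k
      suc-pred (s≤s _) = refl
      Gpoly-N-offdiagonal′ : Gpoly 3 N (suc (ℕ.pred m)) 1F 0F ≡ + 0
      Gpoly-N-offdiagonal′ =
        subst (λ k → Gpoly 3 N k 1F 0F ≡ + 0) (sym (suc-pred 3≤m)) Gpoly-N-offdiagonal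

    A-U-eigen : A *ᵥ U ≗ λ q → a * U q
    A-U-eigen q = trans (A-U q) (trans (cong (λ c → a * U q + c * W q) b≡0) (drop (a * U q) (W q)))
      where
      drop : ∀ u w → u + + 0 * w ≡ u
      drop = solve-∀

    impossible : ⊥
    impossible = G-odd-≢0 3≤m (within3-odd a-within3 a-odd) (begin
      G 3 m a                     ≡⟨ trans (cong (G 3 m a *_) (cong cos-quarter toℕ-p₀)) (ℤP.*-identityʳ _) ⟨
      G 3 m a * U p₀              ≡⟨ Gpoly-*ᵥ-eigen 3 A a U A-U-eigen m p₀ ⟨
      (Gpoly 3 A m *ᵥ U) p₀       ≡⟨ Gpoly-U p₀ ⟩
      + 0                         ∎)
      where open ≡-Reasoning

  excess-impossible : s ≡ - + 1 → ⊥
  excess-impossible s≡-1 =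
    uncurry Excess.impossible (G-odd-≡2 2≤m μ-odd (trans G-μ (cong (_* - + 2) s≡-1)))

module Relabelled {n} (Γ : Graph n) (regular : Regular 3 Γ) (3≤n : 3 ≤ n)
                  {v : Fin n → Fin n} (v-injective : Injective _≡_ _≡_ v)
                  {s} (s-unit : IsUnit s) {m} (2≤m : 2 ≤ m)
                  (equation : ∀ p q → Gpoly 3 (adjMat Γ) m (v p) (v q) ≡ + 1 + s * cycleMat p q) =
  CycleEquation (relabel Γ v) (relabel-rowSums {Γ = Γ} v-injective (regular⇒rowSums {Γ = Γ} regular))
                3≤n s-unit 2≤m (λ p q → trans (Gpoly-relabel 3 (adjMat Γ) v-injective m p q) (equation p q))

no-cyclic-defect : ∀ {D} → 3 ≤ D → ∀ {n} (Γ : Graph n) → ¬ CyclicDefect 3 D Γ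
no-cyclic-defect 3≤D Γ (3≤n , regular , _ , _ , 2≤D , _ , v-injective , equation) =
  Relabelled.defect-impossible Γ regular 3≤n v-injective unit+1 2≤D
    (λ p q → trans (equation p q) (cong (_+_ (+ 1)) (sym (ℤP.*-identityˡ (cycleMat p q))))) refl 3≤D

⌊/2⌋-≥2 : ∀ {g} → 5 ≤ g → 2 ≤ ℕ.⌊ g /2⌋
⌊/2⌋-≥2 (s≤s (s≤s (s≤s (s≤s (s≤s _))))) = s≤s (s≤s z≤n)

no-cyclic-excess : ∀ {g} → 5 ≤ g → ∀ {n} (Γ : Graph n) → ¬ CyclicExcess 3 g Γ
no-cyclic-excess 5≤g Γ (3≤n , regular , _ , _ , _ , _ , _ , v-injective , equation) =
  Relabelled.excess-impossible Γ regular 3≤n v-injective unit-1 (⌊/2⌋-≥2 5≤g)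
    (λ p q → trans (equation p q) (cong (_+_ (+ 1)) (sym (ℤP.-1*i≡-i (cycleMat p q))))) refl

theorem12 : ((D : ℕ) → 3 ≤ D → (n : ℕ) → (Γ : Graph n) → ¬ CyclicDefect 3 D Γ)
            × ((g : ℕ) → g % 2 ≡ 1 → 5 ≤ g → (n : ℕ) → (Γ : Graph n) → ¬ CyclicExcess 3 g Γ)
theorem12 = (λ D 3≤D n Γ → no-cyclic-defect 3≤D Γ) , (λ g _ 5≤g n Γ → no-cyclic-excess 5≤g Γ)
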